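{- Let $F(x_1,\ldots,x_m)$ be a non-degenerate cubic form over a finite field $\mathbb{F}_q$ with $o(F)=m\ge4$. Then $F$ has a non-singular zero, i.e. a point $\mathbf{x}\in\mathbb{F}_q^m\setminus\{\mathbf{0}\}$ with $F(\mathbf{x})=0$ and $\nabla F(\mathbf{x})\ne\mathbf{0}$.
   Context: The order $o(F)$ of a form $F$ over $\mathbb{F}_q$ is the least number of variables appearing explicitly in $F(\tau\mathbf{x})$ as $\tau$ ranges over invertible linear changes of variables over $\mathbb{F}_q$; $F$ is non-degenerate if $o(F)$ equals its number of variables. -}

module Defs where

open import Level using (0ℓ)
open import Algebra.Bundles using (CommutativeRing)
open import Data.Nat using (ℕ; _≤_)
open import Data.Fin using (Fin)
import Data.Fin as Fin
open import Data.Bool using (Bool; true; false; if_then_else_; _∧_; _∨_)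
open import Data.List using (List; length; filter; allFin)
open import Data.List.Relation.Unary.Any using (Any)
open import Data.Product using (Σ; ∃; _×_; _,_)
open import Relation.Nullary using (¬_; Dec; ¬?)
open import Relation.Nullary.Decidable using (⌊_⌋)
open import Relation.Binary using (Decidable)
open import Relation.Binary.PropositionalEquality using (_≡_)
open import Data.Fin.Properties using (any?)

record FiniteField : Set₁ where
  field
    cring    : CommutativeRing 0ℓ 0ℓ
  open CommutativeRing cring public
  field
    1≉0      : ¬ (1# ≈ 0#)
    inverse  : ∀ x → ¬ (x ≈ 0#) → ∃ λ y → x * y ≈ 1#
    _≟_      : Decidable _≈_
    elements : List Carrier
    complete : ∀ x → Any (x ≈_) elements

module _ (K : FiniteField) where
  open FiniteField K

  sumF : ∀ {n} → (Fin n → Carrier) → Carrier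
  sumF {ℕ.zero}  f = 0#
  sumF {ℕ.suc n} f = f Fin.zero + sumF (λ i → f (Fin.suc i))

  -- A cubic form in m variables, F(x) = Σ_{i,j,k} c i j k · x_i x_j x_k
  -- (coefficient tensor; the polynomial is recovered by collecting monomials).
  CubicForm : ℕ → Set
  CubicForm m = Fin m → Fin m → Fin m → Carrier

  Matrix : ℕ → Set
  Matrix m = Fin m → Fin m → Carrier

  _·M_ : ∀ {m} → Matrix m → Matrix m → Matrix m
  (A ·M B) i j = sumF (λ k → A i k * B k j)

  I : ∀ {m} → Matrix m
  I i j = if ⌊ i Fin.≟ j ⌋ then 1# else 0#

  _≈M_ : ∀ {m} → Matrix m → Matrix m → Set
  A ≈M B = ∀ i j → A i j ≈ B i j

  Invertible : ∀ {m} → Matrix m → Set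
  Invertible {m} τ = Σ (Matrix m) λ σ → ((σ ·M τ) ≈M I) × ((τ ·M σ) ≈M I)

  -- the form F(τ y), where x_i = Σ_a τ i a · y_a
  substF : ∀ {m} → Matrix m → CubicForm m → CubicForm m
  substF τ c a b d = sumF λ i → sumF λ j → sumF λ k → c i j k * (τ i a * (τ j b * τ k d))

  isPerm : ∀ {m} → Fin m → Fin m → Fin m → Fin m → Fin m → Fin m → Bool
  isPerm i j k a b c =
       (eq i a ∧ eq j b ∧ eq k c) ∨ (eq i a ∧ eq j c ∧ eq k b)
     ∨ (eq i b ∧ eq j a ∧ eq k c) ∨ (eq i b ∧ eq j c ∧ eq k a)
     ∨ (eq i c ∧ eq j a ∧ eq k b) ∨ (eq i c ∧ eq j b ∧ eq k a)
    where eq = λ u v → ⌊ u Fin.≟ v ⌋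

  -- coefficient of the monomial x_a x_b x_c in the polynomial F
  monoCoeff : ∀ {m} → CubicForm m → Fin m → Fin m → Fin m → Carrier
  monoCoeff c a b d = sumF λ i → sumF λ j → sumF λ k →
    if isPerm i j k a b d then c i j k else 0#

  Appears : ∀ {m} → CubicForm m → Fin m → Set
  Appears c a = ∃ λ b → ∃ λ d → ¬ (monoCoeff c a b d ≈ 0#)

  appears? : ∀ {m} (c : CubicForm m) (a : Fin m) → Dec (Appears c a)
  appears? c a = any? λ b → any? λ d → ¬? (monoCoeff c a b d ≟ 0#)

  numVars : ∀ {m} → CubicForm m → ℕ
  numVars {m} c = length (filter (appears? c) (allFin m))

  -- o(F) = n : n is the least number of variables appearing explicitly in
  -- F(τ x) as τ ranges over invertible linear changes of variables
  HasOrder : ∀ {m} → CubicForm m → ℕ → Set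
  HasOrder {m} c n =
    (Σ (Matrix m) λ τ → Invertible τ × numVars (substF τ c) ≡ n)
    × (∀ (τ : Matrix m) → Invertible τ → n ≤ numVars (substF τ c))


  NonDegenerate : ∀ {m} → CubicForm m → Set
  NonDegenerate {m} c = HasOrder c m

  eval : ∀ {m} → CubicForm m → (Fin m → Carrier) → Carrier
  eval c x = sumF λ i → sumF λ j → sumF λ k → c i j k * (x i * (x j * x k))

  δ : ∀ {m} → Fin m → Fin m → Carrier
  δ = I

  grad : ∀ {m} → CubicForm m → (Fin m → Carrier) → Fin m → Carrier
  grad c x l = sumF λ i → sumF λ j → sumF λ k →
    c i j k * ((δ i l * (x j * x k) + x i * (δ j l * x k)) + x i * (x j * δ k l))

module Submission where

-- The proof is by contradiction, which is legitimate here because "x is a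
-- non-singular zero" is decidable and K^m is finite: either a search over
-- K^m finds a non-singular zero, or none exists, and we refute the latter.
--
--  * Chevalley–Warning (proved from scratch for homogeneous polynomials of
--    degree 0 < d < m via power sums over K) gives a zero a ≠ 0 of F.
--  * If F has no non-singular zero, a is singular, and a line argument
--    shows that the polar D_a F(v) = Σ_l a_l ∂_l F(v) vanishes for all v:
--    otherwise either v itself is a non-singular zero, or a suitable point
--    a + t v of the line through a and v is one.
--  * By polarisation, all the symmetric trilinear sums T(a,·,·) vanish.
--    Choosing an invertible τ whose p-th column is a (with a_p ≠ 0), the
--    variable x_p no longer appears in F(τx), so F has order < m.

open import Defs
open import Data.Nat as ℕ using (ℕ; zero; suc; _≤_; _<_; z≤n; s≤s)
import Data.Nat.Properties as ℕP
open import Data.Nat.Divisibility using (divides; ∣-trans; m∣m*n; m≤n⇒m!∣n!)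
open import Data.Fin as Fin using (Fin; zero; suc)
import Data.Fin.Properties as FinP
open import Data.Bool using (Bool; true; false; if_then_else_; _∧_; _∨_)
open import Data.Bool.Properties using (∨-identityʳ)
open import Data.Product using (Σ; ∃; _×_; _,_; proj₁; proj₂)
open import Data.Sum using (_⊎_; inj₁; inj₂; [_,_]′; fromInj₁)
open import Data.Empty using (⊥; ⊥-elim)
open import Data.List using (List; []; _∷_; _++_; length; allFin; map)
open import Data.List.Properties using (length-++; filter-notAll; length-tabulate)
open import Data.List.Membership.Propositional using (_∈_)
open import Data.List.Membership.Propositional.Properties using (∈-allFin)
open import Data.List.Relation.Unary.All using (All; []; _∷_)
import Data.List.Relation.Unary.All as All
open import Data.List.Relation.Unary.All.Properties using (++⁺)
open import Data.List.Relation.Unary.Any using (Any; here; there)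
import Data.List.Relation.Unary.Any as Any
open import Data.List.Relation.Unary.AllPairs using ([]; _∷_)
open import Data.List.Relation.Unary.Unique.Propositional using (Unique)
open import Relation.Nullary using (¬_; Dec; yes; no; ¬?; _×-dec_; _→-dec_)
open import Relation.Nullary.Decidable using (⌊_⌋; decidable-stable)
import Relation.Binary.PropositionalEquality as ≡
open ≡ using (_≡_; _≢_)

⌊≟⌋-on : ∀ {n} (u : Fin n) → ⌊ u Fin.≟ u ⌋ ≡ true
⌊≟⌋-on u with u Fin.≟ u
... | yes _ = ≡.refl
... | no u≢u = ⊥-elim (u≢u ≡.refl)

⌊≟⌋-off : ∀ {n} {i u : Fin n} → i ≢ u → ⌊ i Fin.≟ u ⌋ ≡ false
⌊≟⌋-off {i = i} {u} i≢u with i Fin.≟ u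
... | yes i≡u = ⊥-elim (i≢u i≡u)
... | no _ = ≡.refl

module Sums (K : FiniteField) where
  open FiniteField K hiding (zero)
  open import Relation.Binary.Reasoning.Setoid setoid
  open import Algebra.Properties.CommutativeMonoid.Sum +-commutativeMonoid
    using (sum; sum-cong-≋; sum-replicate-zero; sum-remove; ∑-distrib-+; ∑-comm; sum-permute)
  open import Algebra.Properties.Semiring.Sum semiring using (*-distribˡ-sum)
  open import Data.Fin.Permutation using (Permutation; _⟨$⟩ʳ_)

  ΣF : ∀ {n} → (Fin n → Carrier) → Carrier
  ΣF = sumF K

  ΣF≡sum : ∀ {n} (f : Fin n → Carrier) → ΣF f ≡ sum f
  ΣF≡sum {zero} f = ≡.refl
  ΣF≡sum {suc n} f = ≡.cong (f zero +_) (ΣF≡sum (λ i → f (suc i)))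

  ΣF-cong : ∀ {n} {f g : Fin n → Carrier} → (∀ i → f i ≈ g i) → ΣF f ≈ ΣF g
  ΣF-cong {f = f} {g} f≈g = begin
    ΣF f  ≡⟨ ΣF≡sum f ⟩
    sum f ≈⟨ sum-cong-≋ f≈g ⟩
    sum g ≡⟨ ΣF≡sum g ⟨
    ΣF g  ∎

  ΣF-zero : ∀ {n} {f : Fin n → Carrier} → (∀ i → f i ≈ 0#) → ΣF f ≈ 0#
  ΣF-zero {n} f≈0 = trans (ΣF-cong f≈0) (trans (reflexive (ΣF≡sum {n} (λ _ → 0#))) (sum-replicate-zero n))

  ΣF-+ : ∀ {n} (f g : Fin n → Carrier) → ΣF (λ i → f i + g i) ≈ ΣF f + ΣF g
  ΣF-+ f g = begin
    ΣF (λ i → f i + g i) ≡⟨ ΣF≡sum (λ i → f i + g i) ⟩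
    sum (λ i → f i + g i) ≈⟨ ∑-distrib-+ f g ⟩
    sum f + sum g        ≡⟨ ≡.cong₂ _+_ (ΣF≡sum f) (ΣF≡sum g) ⟨
    ΣF f + ΣF g          ∎

  ΣF-* : ∀ {n} (a : Carrier) (f : Fin n → Carrier) → ΣF (λ i → a * f i) ≈ a * ΣF f
  ΣF-* a f = begin
    ΣF (λ i → a * f i)  ≡⟨ ΣF≡sum (λ i → a * f i) ⟩
    sum (λ i → a * f i) ≈⟨ *-distribˡ-sum a f ⟨
    a * sum f           ≡⟨ ≡.cong (a *_) (ΣF≡sum f) ⟨
    a * ΣF f            ∎

  ΣF-swap : ∀ {m n} (f : Fin m → Fin n → Carrier) →
    ΣF (λ i → ΣF (λ j → f i j)) ≈ ΣF (λ j → ΣF (λ i → f i j))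
  ΣF-swap f = begin
    ΣF (λ i → ΣF (λ j → f i j))   ≈⟨ ΣF-cong (λ i → reflexive (ΣF≡sum (f i))) ⟩
    ΣF (λ i → sum (λ j → f i j))  ≡⟨ ΣF≡sum (λ i → sum (λ j → f i j)) ⟩
    sum (λ i → sum (λ j → f i j)) ≈⟨ ∑-comm f ⟩
    sum (λ j → sum (λ i → f i j)) ≡⟨ ΣF≡sum (λ j → sum (λ i → f i j)) ⟨
    ΣF (λ j → sum (λ i → f i j))  ≈⟨ ΣF-cong (λ j → reflexive (ΣF≡sum (λ i → f i j))) ⟨
    ΣF (λ j → ΣF (λ i → f i j))   ∎

  ΣF-select : ∀ {n} (u : Fin n) (g : Fin n → Carrier) → (∀ i → i ≢ u → g i ≈ 0#) → ΣF g ≈ g u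
  ΣF-select {suc n} u g off = begin
    ΣF g                         ≡⟨ ΣF≡sum g ⟩
    sum g                        ≈⟨ sum-remove {i = u} g ⟩
    g u + sum (Vec.removeAt g u) ≈⟨ +-congˡ (trans (sum-cong-≋ others) (sum-replicate-zero n)) ⟩
    g u + 0#                     ≈⟨ +-identityʳ (g u) ⟩
    g u                          ∎
    where
    import Data.Vec.Functional as Vec
    others : ∀ j → Vec.removeAt g u j ≈ 0#
    others j = off (Fin.punchIn u j) (FinP.punchInᵢ≢i u j)

  ΣF-permute : ∀ {n} (f : Fin n → Carrier) (π : Permutation n n) → ΣF f ≈ ΣF (λ i → f (π ⟨$⟩ʳ i))
  ΣF-permute f π = begin
    ΣF f                      ≡⟨ ΣF≡sum f ⟩
    sum f                     ≈⟨ sum-permute f π ⟩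
    sum (λ i → f (π ⟨$⟩ʳ i))  ≡⟨ ΣF≡sum (λ i → f (π ⟨$⟩ʳ i)) ⟨
    ΣF (λ i → f (π ⟨$⟩ʳ i))   ∎

  S3 : ∀ {m} → (Fin m → Fin m → Fin m → Carrier) → Carrier
  S3 f = ΣF λ i → ΣF λ j → ΣF λ k → f i j k

  S3-cong : ∀ {m} {f g : Fin m → Fin m → Fin m → Carrier} →
    (∀ i j k → f i j k ≈ g i j k) → S3 f ≈ S3 g
  S3-cong h = ΣF-cong λ i → ΣF-cong λ j → ΣF-cong λ k → h i j k

  S3-zero : ∀ {m} {f : Fin m → Fin m → Fin m → Carrier} → (∀ i j k → f i j k ≈ 0#) → S3 f ≈ 0#
  S3-zero h = ΣF-zero λ i → ΣF-zero λ j → ΣF-zero λ k → h i j k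

  S3-+ : ∀ {m} (f g : Fin m → Fin m → Fin m → Carrier) →
    S3 (λ i j k → f i j k + g i j k) ≈ S3 f + S3 g
  S3-+ f g = trans (ΣF-cong λ i → trans (ΣF-cong λ j → ΣF-+ (f i j) (g i j))
                                        (ΣF-+ (λ j → ΣF (f i j)) (λ j → ΣF (g i j))))
                   (ΣF-+ (λ i → ΣF λ j → ΣF (f i j)) (λ i → ΣF λ j → ΣF (g i j)))

  S3-* : ∀ {m} a (f : Fin m → Fin m → Fin m → Carrier) → S3 (λ i j k → a * f i j k) ≈ a * S3 f
  S3-* a f = trans (ΣF-cong λ i → trans (ΣF-cong λ j → ΣF-* a (f i j)) (ΣF-* a (λ j → ΣF (f i j))))
                   (ΣF-* a (λ i → ΣF λ j → ΣF (f i j)))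

  ΣF-S3 : ∀ {m n} (H : Fin n → Fin m → Fin m → Fin m → Carrier) →
    ΣF (λ l → S3 (H l)) ≈ S3 (λ i j k → ΣF (λ l → H l i j k))
  ΣF-S3 H = trans (ΣF-swap (λ l i → ΣF λ j → ΣF λ k → H l i j k))
    (ΣF-cong λ i → trans (ΣF-swap (λ l j → ΣF λ k → H l i j k))
                         (ΣF-cong λ j → ΣF-swap (λ l k → H l i j k)))

  I-diag : ∀ {n} (i : Fin n) → I K i i ≈ 1#
  I-diag i = reflexive (≡.cong (if_then 1# else 0#) (⌊≟⌋-on i))

  I-off : ∀ {n} (i j : Fin n) → i ≢ j → I K i j ≈ 0#
  I-off i j i≢j = reflexive (≡.cong (if_then 1# else 0#) (⌊≟⌋-off i≢j))

  I-sym : ∀ {n} (i j : Fin n) → I K i j ≈ I K j i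
  I-sym i j with i Fin.≟ j
  ... | yes ≡.refl = sym (I-diag i)
  ... | no i≢j = sym (I-off j i (λ e → i≢j (≡.sym e)))

  ΣF-δ : ∀ {n} (i : Fin n) (y : Fin n → Carrier) → ΣF (λ l → I K i l * y l) ≈ y i
  ΣF-δ i y = trans (ΣF-select i _ (λ l l≢i → trans (*-congʳ (I-off i l (λ e → l≢i (≡.sym e)))) (zeroˡ _)))
                   (trans (*-congʳ (I-diag i)) (*-identityˡ _))

module FieldFacts (K : FiniteField) where
  open FiniteField K hiding (zero)
  open import Relation.Binary.Reasoning.Setoid setoid
  open import Algebra.Properties.Group +-group using (⁻¹-injective; ε⁻¹≈ε)

  *-cancelˡ : ∀ {x y z} → ¬ x ≈ 0# → x * y ≈ x * z → y ≈ z
  *-cancelˡ {x} {y} {z} x≉0 xy≈xz with inverse x x≉0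
  ... | x⁻¹ , xx⁻¹≈1 = begin
    y              ≈⟨ undo y ⟨
    x⁻¹ * (x * y)  ≈⟨ *-congˡ xy≈xz ⟩
    x⁻¹ * (x * z)  ≈⟨ undo z ⟩
    z              ∎
    where
    undo : ∀ w → x⁻¹ * (x * w) ≈ w
    undo w = trans (sym (*-assoc _ _ _))
               (trans (*-congʳ (trans (*-comm x⁻¹ x) xx⁻¹≈1)) (*-identityˡ w))

  *-nonzero : ∀ {x y} → ¬ x ≈ 0# → ¬ y ≈ 0# → ¬ x * y ≈ 0#
  *-nonzero x≉0 y≉0 xy≈0 = y≉0 (*-cancelˡ x≉0 (trans xy≈0 (sym (zeroʳ _))))

  -‿nonzero : ∀ {x} → ¬ x ≈ 0# → ¬ - x ≈ 0#
  -‿nonzero x≉0 -x≈0 = x≉0 (⁻¹-injective (trans -x≈0 (sym ε⁻¹≈ε)))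

module CubicCalculus (K : FiniteField) {m : ℕ} (c : CubicForm K m) where
  open FiniteField K hiding (zero)
  open import Relation.Binary.Reasoning.Setoid setoid
  open import Algebra.Solver.Ring.NaturalCoefficients.Default commutativeSemiring
  open import Algebra.Properties.Ring ring using (-‿distribˡ-*)
  open Sums K
  open FieldFacts K

  Point : Set
  Point = Fin m → Carrier

  IsZero : Point → Set
  IsZero x = ∀ i → x i ≈ 0#

  isZero? : ∀ x → Dec (IsZero x)
  isZero? x = FinP.all? (λ i → x i ≟ 0#)

  F : Point → Carrier
  F = eval K c

  ∇F : Point → Fin m → Carrier
  ∇F = grad K c

  NonsingularZero : Point → Set
  NonsingularZero x = ¬ IsZero x × F x ≈ 0# × ¬ (∀ l → ∇F x l ≈ 0#)

  T : Point → Point → Point → Carrier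
  T u v w = S3 λ i j k → c i j k * (u i * (v j * w k))

  T-cong : ∀ {u u′ v v′ w w′ : Point} →
    (∀ i → u i ≈ u′ i) → (∀ i → v i ≈ v′ i) → (∀ i → w i ≈ w′ i) → T u v w ≈ T u′ v′ w′
  T-cong hu hv hw = S3-cong λ i j k → *-congˡ (*-cong (hu i) (*-cong (hv j) (hw k)))

  F-cong : ∀ {x y} → (∀ i → x i ≈ y i) → F x ≈ F y
  F-cong h = T-cong h h h

  ∇F-cong : ∀ {x y} → (∀ i → x i ≈ y i) → ∀ l → ∇F x l ≈ ∇F y l
  ∇F-cong h l = S3-cong λ i j k → *-congˡ
    (+-cong (+-cong (*-congˡ (*-cong (h j) (h k))) (*-cong (h i) (*-congˡ (h k))))
            (*-cong (h i) (*-congʳ (h j))))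

  nonsingularZero? : ∀ x → Dec (NonsingularZero x)
  nonsingularZero? x = ¬? (isZero? x) ×-dec (F x ≟ 0#) ×-dec ¬? (FinP.all? (λ l → ∇F x l ≟ 0#))

  nonsingularZero-resp : ∀ {x y} → (∀ i → x i ≈ y i) → NonsingularZero x → NonsingularZero y
  nonsingularZero-resp x≈y (x≉0 , Fx≈0 , ∇Fx≉0) =
      (λ y≈0 → x≉0 (λ i → trans (x≈y i) (y≈0 i)))
    , trans (sym (F-cong x≈y)) Fx≈0
    , (λ ∇Fy≈0 → ∇Fx≉0 (λ l → trans (∇F-cong x≈y l) (∇Fy≈0 l)))

  D : Point → Point → Carrier
  D x y = S3 λ i j k → c i j k * ((y i * (x j * x k) + x i * (y j * x k)) + x i * (x j * y k))

  D-T : ∀ x y → D x y ≈ (T y x x + T x y x) + T x x y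
  D-T x y = trans (S3-cong λ i j k → trans (distribˡ (c i j k) _ _) (+-congʳ (distribˡ (c i j k) _ _)))
    (trans (S3-+ (λ i j k → c i j k * (y i * (x j * x k)) + c i j k * (x i * (y j * x k)))
                 (λ i j k → c i j k * (x i * (x j * y k))))
           (+-congʳ (S3-+ (λ i j k → c i j k * (y i * (x j * x k)))
                          (λ i j k → c i j k * (x i * (y j * x k))))))

  D-∇F : ∀ x y → D x y ≈ ΣF (λ l → y l * ∇F x l)
  D-∇F x y = sym (begin
    ΣF (λ l → y l * ∇F x l)                    ≈⟨ ΣF-cong (λ l → sym (S3-* {m} (y l) (G l))) ⟩
    ΣF (λ l → S3 (λ i j k → y l * G l i j k))  ≈⟨ ΣF-S3 (λ l i j k → y l * G l i j k) ⟩
    S3 (λ i j k → ΣF (λ l → y l * G l i j k))  ≈⟨ S3-cong contract ⟩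
    D x y                                      ∎)
    where
    G : Fin m → Fin m → Fin m → Fin m → Carrier
    G l i j k = c i j k * ((I K i l * (x j * x k) + x i * (I K j l * x k)) + x i * (x j * I K k l))
    -- each δ_il contracts with y_l to y_i
    contract : ∀ i j k → ΣF (λ l → y l * G l i j k) ≈
      c i j k * ((y i * (x j * x k) + x i * (y j * x k)) + x i * (x j * y k))
    contract i j k = begin
      ΣF (λ l → y l * G l i j k)
        ≈⟨ ΣF-cong (λ l → solve 8 (λ yl cc a b d xi xj xk →
             yl :* (cc :* ((a :* (xj :* xk) :+ xi :* (b :* xk)) :+ xi :* (xj :* d)))
          := (cc :* (xj :* xk)) :* (a :* yl) :+ ((cc :* (xi :* xk)) :* (b :* yl) :+ (cc :* (xi :* xj)) :* (d :* yl)))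
          refl (y l) (c i j k) (I K i l) (I K j l) (I K k l) (x i) (x j) (x k)) ⟩
      ΣF (λ l → α * (I K i l * y l) + (β * (I K j l * y l) + γ * (I K k l * y l)))
        ≈⟨ trans (ΣF-+ {m} _ _) (+-congˡ (ΣF-+ {m} _ _)) ⟩
      ΣF (λ l → α * (I K i l * y l)) + (ΣF (λ l → β * (I K j l * y l)) + ΣF (λ l → γ * (I K k l * y l)))
        ≈⟨ +-cong (picks α i) (+-cong (picks β j) (picks γ k)) ⟩
      α * y i + (β * y j + γ * y k)
        ≈⟨ solve 7 (λ cc xi xj xk yi yj yk →
             (cc :* (xj :* xk)) :* yi :+ ((cc :* (xi :* xk)) :* yj :+ (cc :* (xi :* xj)) :* yk)
          := cc :* ((yi :* (xj :* xk) :+ xi :* (yj :* xk)) :+ xi :* (xj :* yk)))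
          refl (c i j k) (x i) (x j) (x k) (y i) (y j) (y k) ⟩
      c i j k * ((y i * (x j * x k) + x i * (y j * x k)) + x i * (x j * y k)) ∎
      where
      α β γ : Carrier
      α = c i j k * (x j * x k)
      β = c i j k * (x i * x k)
      γ = c i j k * (x i * x j)
      picks : ∀ w r → ΣF (λ l → w * (I K r l * y l)) ≈ w * y r
      picks w r = trans (ΣF-* {m} w _) (*-congˡ (ΣF-δ r y))

  D-singular : ∀ x → (∀ l → ∇F x l ≈ 0#) → ∀ y → D x y ≈ 0#
  D-singular x ∇F≈0 y = trans (D-∇F x y) (ΣF-zero (λ l → trans (*-congˡ (∇F≈0 l)) (zeroʳ _)))

  D-at-zero : ∀ x y → IsZero x → D x y ≈ 0#
  D-at-zero x y x≈0 = S3-zero λ i j k → begin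
    c i j k * ((y i * (x j * x k) + x i * (y j * x k)) + x i * (x j * y k))
      ≈⟨ *-congˡ (+-cong (+-cong (*-congˡ (*-cong (x≈0 j) (x≈0 k))) (*-cong (x≈0 i) (*-congˡ (x≈0 k))))
                         (*-cong (x≈0 i) (*-congʳ (x≈0 j)))) ⟩
    c i j k * ((y i * (0# * 0#) + 0# * (y j * 0#)) + 0# * (0# * y k))
      ≈⟨ solve 4 (λ cc a b d → cc :* ((a :* (con 0 :* con 0) :+ con 0 :* (b :* con 0)) :+ con 0 :* (con 0 :* d))
                            := con 0) refl (c i j k) (y i) (y j) (y k) ⟩
    0# ∎

  F-line : ∀ a b t → F (λ i → a i + t * b i) ≈ F a + (t * D a b + ((t * t) * D b a + ((t * t) * t) * F b))
  F-line a b t = begin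
    F (λ i → a i + t * b i)
      ≈⟨ S3-cong (λ i j k → solve 8 (λ cc ai aj ak bi bj bk tt →
           cc :* ((ai :+ tt :* bi) :* ((aj :+ tt :* bj) :* (ak :+ tt :* bk)))
         := cc :* (ai :* (aj :* ak)) :+ (tt :* (cc :* ((bi :* (aj :* ak) :+ ai :* (bj :* ak)) :+ ai :* (aj :* bk)))
            :+ ((tt :* tt) :* (cc :* ((ai :* (bj :* bk) :+ bi :* (aj :* bk)) :+ bi :* (bj :* ak)))
            :+ ((tt :* tt) :* tt) :* (cc :* (bi :* (bj :* bk))))))
         refl (c i j k) (a i) (a j) (a k) (b i) (b j) (b k) t) ⟩
      S3 (λ i j k → P₀ i j k + (t * P₁ i j k + ((t * t) * P₂ i j k + ((t * t) * t) * P₃ i j k)))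
      ≈⟨ trans (S3-+ {m} _ _) (+-congˡ (trans (S3-+ {m} _ _) (+-cong (S3-* {m} t P₁)
           (trans (S3-+ {m} _ _) (+-cong (S3-* {m} (t * t) P₂) (S3-* {m} ((t * t) * t) P₃)))))) ⟩
    F a + (t * D a b + ((t * t) * D b a + ((t * t) * t) * F b)) ∎
    where
    P₀ P₁ P₂ P₃ : Fin m → Fin m → Fin m → Carrier
    P₀ i j k = c i j k * (a i * (a j * a k))
    P₁ i j k = c i j k * ((b i * (a j * a k) + a i * (b j * a k)) + a i * (a j * b k))
    P₂ i j k = c i j k * ((a i * (b j * b k) + b i * (a j * b k)) + b i * (b j * a k))
    P₃ i j k = c i j k * (b i * (b j * b k))

  D-line : ∀ a b t → D (λ i → a i + t * b i) b ≈ D a b + (t * (D b a + D b a) + (t * t) * (F b + (F b + F b)))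
  D-line a b t = begin
    D (λ i → a i + t * b i) b
      ≈⟨ S3-cong (λ i j k → solve 8 (λ cc ai aj ak bi bj bk tt →
           cc :* ((bi :* ((aj :+ tt :* bj) :* (ak :+ tt :* bk)) :+ (ai :+ tt :* bi) :* (bj :* (ak :+ tt :* bk)))
                  :+ (ai :+ tt :* bi) :* ((aj :+ tt :* bj) :* bk))
         := cc :* ((bi :* (aj :* ak) :+ ai :* (bj :* ak)) :+ ai :* (aj :* bk))
            :+ (tt :* (cc :* ((ai :* (bj :* bk) :+ bi :* (aj :* bk)) :+ bi :* (bj :* ak))
                       :+ cc :* ((ai :* (bj :* bk) :+ bi :* (aj :* bk)) :+ bi :* (bj :* ak)))
            :+ (tt :* tt) :* (cc :* (bi :* (bj :* bk)) :+ (cc :* (bi :* (bj :* bk)) :+ cc :* (bi :* (bj :* bk))))))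
         refl (c i j k) (a i) (a j) (a k) (b i) (b j) (b k) t) ⟩
    S3 (λ i j k → P₁ i j k + (t * (P₂ i j k + P₂ i j k) + (t * t) * (P₃ i j k + (P₃ i j k + P₃ i j k))))
      ≈⟨ trans (S3-+ {m} _ _) (+-congˡ (trans (S3-+ {m} _ _) (+-cong
           (trans (S3-* {m} t _) (*-congˡ (S3-+ P₂ P₂)))
           (trans (S3-* {m} (t * t) _) (*-congˡ (trans (S3-+ P₃ _) (+-congˡ (S3-+ P₃ P₃)))))))) ⟩
    D a b + (t * (D b a + D b a) + (t * t) * (F b + (F b + F b))) ∎
    where
    P₁ P₂ P₃ : Fin m → Fin m → Fin m → Carrier
    P₁ i j k = c i j k * ((b i * (a j * a k) + a i * (b j * a k)) + a i * (a j * b k))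
    P₂ i j k = c i j k * ((a i * (b j * b k) + b i * (a j * b k)) + b i * (b j * a k))
    P₃ i j k = c i j k * (b i * (b j * b k))

  Six : Point → Point → Point → Carrier
  Six a v w = T a v w + (T a w v + (T v a w + (T v w a + (T w a v + T w v a))))

  -- Polarisation: D_a F is a quadratic form whose associated bilinear form is Six a.
  polarisation : ∀ a v w → D (λ i → v i + w i) a ≈ D v a + (D w a + Six a v w)
  polarisation a v w = begin
    D (λ i → v i + w i) a
      ≈⟨ S3-cong (λ i j k → solve 10 (λ cc ai aj ak vi vj vk wi wj wk →
            cc :* ((ai :* ((vj :+ wj) :* (vk :+ wk)) :+ (vi :+ wi) :* (aj :* (vk :+ wk))) :+ (vi :+ wi) :* ((vj :+ wj) :* ak))
         := cc :* ((ai :* (vj :* vk) :+ vi :* (aj :* vk)) :+ vi :* (vj :* ak))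
            :+ (cc :* ((ai :* (wj :* wk) :+ wi :* (aj :* wk)) :+ wi :* (wj :* ak))
            :+ (cc :* (ai :* (vj :* wk)) :+ (cc :* (ai :* (wj :* vk)) :+ (cc :* (vi :* (aj :* wk))
            :+ (cc :* (vi :* (wj :* ak)) :+ (cc :* (wi :* (aj :* vk)) :+ cc :* (wi :* (vj :* ak)))))))))
         refl (c i j k) (a i) (a j) (a k) (v i) (v j) (v k) (w i) (w j) (w k)) ⟩
    S3 (λ i j k → Q v i j k + (Q w i j k + (R a v w i j k + (R a w v i j k + (R v a w i j k
                  + (R v w a i j k + (R w a v i j k + R w v a i j k)))))))
      ≈⟨ trans (S3-+ {m} _ _) (+-congˡ (trans (S3-+ {m} _ _) (+-congˡ (trans (S3-+ {m} _ _) (+-congˡ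
           (trans (S3-+ {m} _ _) (+-congˡ (trans (S3-+ {m} _ _) (+-congˡ (trans (S3-+ {m} _ _) (+-congˡ (S3-+ {m} _ _)))))))))))) ⟩
    D v a + (D w a + Six a v w) ∎
    where
    Q : Point → Fin m → Fin m → Fin m → Carrier
    Q x i j k = c i j k * ((a i * (x j * x k) + x i * (a j * x k)) + x i * (x j * a k))
    R : Point → Point → Point → Fin m → Fin m → Fin m → Carrier
    R x y z i j k = c i j k * (x i * (y j * z k))

  Six-vanishes : ∀ a → (∀ v → D v a ≈ 0#) → ∀ v w → Six a v w ≈ 0#
  Six-vanishes a polar≈0 v w = begin
    Six a v w                       ≈⟨ trans (+-identityˡ _) (+-identityˡ _) ⟨
    0# + (0# + Six a v w)           ≈⟨ +-cong (polar≈0 v) (+-congʳ (polar≈0 w)) ⟨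
    D v a + (D w a + Six a v w)     ≈⟨ polarisation a v w ⟨
    D (λ i → v i + w i) a           ≈⟨ polar≈0 _ ⟩
    0#                              ∎

  F-line-singular : ∀ a b t → F a ≈ 0# → (∀ y → D a y ≈ 0#) →
    F (λ i → a i + t * b i) ≈ (t * t) * (D b a + t * F b)
  F-line-singular a b t Fa≈0 a-singular = begin
    F (λ i → a i + t * b i)                                        ≈⟨ F-line a b t ⟩
    F a + (t * D a b + ((t * t) * D b a + ((t * t) * t) * F b))    ≈⟨ +-cong Fa≈0 (+-congʳ (*-congˡ (a-singular b))) ⟩
    0# + (t * 0# + ((t * t) * D b a + ((t * t) * t) * F b))
      ≈⟨ solve 3 (λ tt qq ff → con 0 :+ (tt :* con 0 :+ ((tt :* tt) :* qq :+ ((tt :* tt) :* tt) :* ff))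
                            := (tt :* tt) :* (qq :+ tt :* ff)) refl t (D b a) (F b) ⟩
    (t * t) * (D b a + t * F b)                                    ∎

  D-line-singular : ∀ a b t → (∀ y → D a y ≈ 0#) →
    D (λ i → a i + t * b i) b ≈ t * ((D b a + D b a) + (t * F b + (t * F b + t * F b)))
  D-line-singular a b t a-singular = begin
    D (λ i → a i + t * b i) b                                      ≈⟨ D-line a b t ⟩
    D a b + (t * (D b a + D b a) + (t * t) * (F b + (F b + F b)))  ≈⟨ +-congʳ (a-singular b) ⟩
    0# + (t * (D b a + D b a) + (t * t) * (F b + (F b + F b)))
      ≈⟨ solve 3 (λ tt qq ff → con 0 :+ (tt :* (qq :+ qq) :+ (tt :* tt) :* (ff :+ (ff :+ ff)))
                            := tt :* ((qq :+ qq) :+ (tt :* ff :+ (tt :* ff :+ tt :* ff)))) refl t (D b a) (F b) ⟩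
    t * ((D b a + D b a) + (t * F b + (t * F b + t * F b)))        ∎

  -- The line argument.  Let a be a singular zero and b a point with
  -- F(b) ≠ 0 and q = D_a F(b) ≠ 0.  For t = -q/F(b) the point a + t b is a
  -- zero, at which D_b F = t(2q - 3q) = -t q ≠ 0.
  line : ∀ a b → F a ≈ 0# → (∀ y → D a y ≈ 0#) → ¬ F b ≈ 0# → ¬ D b a ≈ 0# →
    Σ Point NonsingularZero
  line a b Fa≈0 a-singular f≉0 q≉0 with inverse (F b) f≉0
  ... | z , fz≈1 = x , x≉0 , Fx≈0 , ∇Fx≉0
    where
    f q t : Carrier
    f = F b
    q = D b a
    t = - (q * z)
    x : Point
    x i = a i + t * b i
    z≉0 : ¬ z ≈ 0#
    z≉0 z≈0 = 1≉0 (trans (sym fz≈1) (trans (*-congˡ z≈0) (zeroʳ f)))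
    t≉0 : ¬ t ≈ 0#
    t≉0 = -‿nonzero (*-nonzero q≉0 z≉0)
    tf≈-q : t * f ≈ - q
    tf≈-q = begin
      - (q * z) * f   ≈⟨ -‿distribˡ-* (q * z) f ⟨
      - ((q * z) * f) ≈⟨ -‿cong (trans (*-assoc q z f) (trans (*-congˡ (trans (*-comm z f) fz≈1)) (*-identityʳ q))) ⟩
      - q             ∎
    Fx≈0 : F x ≈ 0#
    Fx≈0 = begin
      F x                    ≈⟨ F-line-singular a b t Fa≈0 a-singular ⟩
      (t * t) * (q + t * f)  ≈⟨ *-congˡ (trans (+-congˡ tf≈-q) (-‿inverseʳ q)) ⟩
      (t * t) * 0#           ≈⟨ zeroʳ _ ⟩
      0#                     ∎
    Dx≈-tq : D x b ≈ t * - q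
    Dx≈-tq = begin
      D x b                                      ≈⟨ D-line-singular a b t a-singular ⟩
      t * ((q + q) + (t * f + (t * f + t * f)))  ≈⟨ *-congˡ (+-congˡ (+-cong tf≈-q (+-cong tf≈-q tf≈-q))) ⟩
      t * ((q + q) + (- q + (- q + - q)))
        ≈⟨ *-congˡ (solve 2 (λ qq nq → (qq :+ qq) :+ (nq :+ (nq :+ nq)) := (qq :+ nq) :+ ((qq :+ nq) :+ nq)) refl q (- q)) ⟩
      t * ((q + - q) + ((q + - q) + - q))        ≈⟨ *-congˡ (+-cong (-‿inverseʳ q) (+-congʳ (-‿inverseʳ q))) ⟩
      t * (0# + (0# + - q))                      ≈⟨ *-congˡ (trans (+-identityˡ _) (+-identityˡ _)) ⟩
      t * - q                                    ∎
    Dx≉0 : ¬ D x b ≈ 0#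
    Dx≉0 Dx≈0 = *-nonzero t≉0 (-‿nonzero q≉0) (trans (sym Dx≈-tq) Dx≈0)
    -- a point at which some directional derivative is non-zero is neither 0 nor singular
    x≉0 : ¬ IsZero x
    x≉0 x≈0 = Dx≉0 (D-at-zero x b x≈0)
    ∇Fx≉0 : ¬ (∀ l → ∇F x l ≈ 0#)
    ∇Fx≉0 ∇Fx≈0 = Dx≉0 (D-singular x ∇Fx≈0 b)

  polar-vanishes : (∀ x → ¬ NonsingularZero x) →
    ∀ a → ¬ IsZero a → F a ≈ 0# → (∀ y → D a y ≈ 0#) → ∀ v → D v a ≈ 0#
  polar-vanishes none a a≉0 Fa≈0 a-singular v = decidable-stable (D v a ≟ 0#) λ q≉0 →
    case-F (F v ≟ 0#) q≉0
    where
    case-F : Dec (F v ≈ 0#) → ¬ D v a ≈ 0# → ⊥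
    case-F (no f≉0) q≉0 = none _ (proj₂ (line a v Fa≈0 a-singular f≉0 q≉0))
    case-F (yes Fv≈0) q≉0 = none v (v≉0 , Fv≈0 , ∇Fv≉0)
      where
      v≉0 : ¬ IsZero v
      v≉0 v≈0 = q≉0 (D-at-zero v a v≈0)
      ∇Fv≉0 : ¬ (∀ l → ∇F v l ≈ 0#)
      ∇Fv≉0 ∇Fv≈0 = q≉0 (D-singular v ∇Fv≈0 a)

module MonomialCoefficients (K : FiniteField) where
  open FiniteField K hiding (zero)
  open import Relation.Binary.Reasoning.Setoid setoid
  open import Data.Bool.Properties using (∨-idempotentCommutativeMonoid)
  open import Algebra.Solver.IdempotentCommutativeMonoid ∨-idempotentCommutativeMonoid
    renaming (solve to solve-∨)
  open Sums K

  Triple : ℕ → Set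
  Triple m = Fin m × Fin m × Fin m

  matches : ∀ {m} → Triple m → Fin m → Fin m → Fin m → Bool
  matches (u , v , w) i j k = ⌊ i Fin.≟ u ⌋ ∧ ⌊ j Fin.≟ v ⌋ ∧ ⌊ k Fin.≟ w ⌋

  matchesAny : ∀ {m} → List (Triple m) → Fin m → Fin m → Fin m → Bool
  matchesAny [] i j k = false
  matchesAny (t ∷ ts) i j k = matches t i j k ∨ matchesAny ts i j k

  sumAt : ∀ {m} → CubicForm K m → List (Triple m) → Carrier
  sumAt X [] = 0#
  sumAt X ((u , v , w) ∷ ts) = X u v w + sumAt X ts

  ≟-sound : ∀ {n} (i u : Fin n) → ⌊ i Fin.≟ u ⌋ ≡ true → i ≡ u
  ≟-sound i u h with i Fin.≟ u
  ≟-sound i u h  | yes i≡u = i≡u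
  ≟-sound i u () | no _

  matches-sound : ∀ {m} (t : Triple m) i j k → matches t i j k ≡ true → (i , j , k) ≡ t
  matches-sound (u , v , w) i j k h with ⌊ i Fin.≟ u ⌋ in eu | ⌊ j Fin.≟ v ⌋ in ev | ⌊ k Fin.≟ w ⌋ in ew
  ... | true | true | true = ≡.cong₂ _,_ (≟-sound i u eu) (≡.cong₂ _,_ (≟-sound j v ev) (≟-sound k w ew))

  matchesAny-sound : ∀ {m} (ts : List (Triple m)) i j k → matchesAny ts i j k ≡ true → (i , j , k) ∈ ts
  matchesAny-sound (t ∷ ts) i j k h with matches t i j k in et
  ... | true = here (matches-sound t i j k et)
  ... | false = there (matchesAny-sound ts i j k h)

  if-∨ : ∀ x y (v : Carrier) → ¬ (x ≡ true × y ≡ true) →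
    (if x ∨ y then v else 0#) ≈ (if x then v else 0#) + (if y then v else 0#)
  if-∨ true true v both = ⊥-elim (both (≡.refl , ≡.refl))
  if-∨ true false v _ = sym (+-identityʳ v)
  if-∨ false true v _ = sym (+-identityˡ v)
  if-∨ false false v _ = sym (+-identityˡ 0#)

  select-one : ∀ {m} (X : CubicForm K m) u v w →
    S3 (λ i j k → if matches (u , v , w) i j k then X i j k else 0#) ≈ X u v w
  select-one X u v w = begin
    S3 (λ i j k → if ⌊ i Fin.≟ u ⌋ ∧ ⌊ j Fin.≟ v ⌋ ∧ ⌊ k Fin.≟ w ⌋ then X i j k else 0#)
      ≈⟨ ΣF-select u _ (λ i i≢u → ΣF-zero λ j → ΣF-zero λ k →
           off (λ b → if b ∧ ⌊ j Fin.≟ v ⌋ ∧ ⌊ k Fin.≟ w ⌋ then X i j k else 0#) i≢u) ⟩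
    ΣF (λ j → ΣF λ k → if ⌊ u Fin.≟ u ⌋ ∧ ⌊ j Fin.≟ v ⌋ ∧ ⌊ k Fin.≟ w ⌋ then X u j k else 0#)
      ≈⟨ ΣF-cong (λ j → ΣF-cong λ k → on (λ b → if b ∧ ⌊ j Fin.≟ v ⌋ ∧ ⌊ k Fin.≟ w ⌋ then X u j k else 0#) u) ⟩
    ΣF (λ j → ΣF λ k → if ⌊ j Fin.≟ v ⌋ ∧ ⌊ k Fin.≟ w ⌋ then X u j k else 0#)
      ≈⟨ ΣF-select v _ (λ j j≢v → ΣF-zero λ k → off (λ b → if b ∧ ⌊ k Fin.≟ w ⌋ then X u j k else 0#) j≢v) ⟩
    ΣF (λ k → if ⌊ v Fin.≟ v ⌋ ∧ ⌊ k Fin.≟ w ⌋ then X u v k else 0#)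
      ≈⟨ ΣF-cong (λ k → on (λ b → if b ∧ ⌊ k Fin.≟ w ⌋ then X u v k else 0#) v) ⟩
    ΣF (λ k → if ⌊ k Fin.≟ w ⌋ then X u v k else 0#)
      ≈⟨ ΣF-select w _ (λ k k≢w → off (λ b → if b then X u v k else 0#) k≢w) ⟩
    (if ⌊ w Fin.≟ w ⌋ then X u v w else 0#)
      ≈⟨ on (λ b → if b then X u v w else 0#) w ⟩
    X u v w ∎
    where
    off : ∀ {n} {i u : Fin n} (g : Bool → Carrier) → i ≢ u → g ⌊ i Fin.≟ u ⌋ ≈ g false
    off g i≢u = reflexive (≡.cong g (⌊≟⌋-off i≢u))
    on : ∀ {n} (g : Bool → Carrier) (u : Fin n) → g ⌊ u Fin.≟ u ⌋ ≈ g true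
    on g u = reflexive (≡.cong g (⌊≟⌋-on u))

  select-distinct : ∀ {m} (X : CubicForm K m) (ts : List (Triple m)) → Unique ts →
    S3 (λ i j k → if matchesAny ts i j k then X i j k else 0#) ≈ sumAt X ts
  select-distinct {m} X [] _ = S3-zero {m} (λ _ _ _ → refl)
  select-distinct {m} X ((u , v , w) ∷ ts) (t∉ts ∷ distinct) = begin
    S3 (λ i j k → if matches (u , v , w) i j k ∨ matchesAny ts i j k then X i j k else 0#)
      ≈⟨ S3-cong (λ i j k → if-∨ _ _ (X i j k) (disjoint i j k)) ⟩
    S3 (λ i j k → (if matches (u , v , w) i j k then X i j k else 0#) + (if matchesAny ts i j k then X i j k else 0#))
      ≈⟨ S3-+ {m} _ _ ⟩
    S3 (λ i j k → if matches (u , v , w) i j k then X i j k else 0#) + S3 (λ i j k → if matchesAny ts i j k then X i j k else 0#)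
      ≈⟨ +-cong (select-one X u v w) (select-distinct X ts distinct) ⟩
    X u v w + sumAt X ts ∎
    where
    disjoint : ∀ i j k → ¬ (matches (u , v , w) i j k ≡ true × matchesAny ts i j k ≡ true)
    -- since t ∉ ts, no index triple matches both
    disjoint i j k (here₁ , here₂) =
      All.lookup t∉ts (matchesAny-sound ts i j k here₂) (≡.sym (matches-sound (u , v , w) i j k here₁))

  monoCoeff-as : ∀ {m} (X : CubicForm K m) a b d (ts : List (Triple m)) → Unique ts →
    (∀ i j k → isPerm K i j k a b d ≡ matchesAny ts i j k) → monoCoeff K X a b d ≈ sumAt X ts
  monoCoeff-as X a b d ts distinct same =
    trans (S3-cong λ i j k → reflexive (≡.cong (λ β → if β then X i j k else 0#) (same i j k)))
          (select-distinct X ts distinct)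

  differ₁ : ∀ {m} {u v w u′ v′ w′ : Fin m} → u ≢ u′ → (u , v , w) ≢ (u′ , v′ , w′)
  differ₁ u≢u′ e = u≢u′ (≡.cong proj₁ e)

  differ₂ : ∀ {m} {u v w u′ v′ w′ : Fin m} → v ≢ v′ → (u , v , w) ≢ (u′ , v′ , w′)
  differ₂ v≢v′ e = v≢v′ (≡.cong (λ t → proj₁ (proj₂ t)) e)

  nested₃ : ∀ x y z → x + (y + (z + 0#)) ≈ (x + y) + z
  nested₃ x y z = trans (+-congˡ (+-congˡ (+-identityʳ z))) (sym (+-assoc x y z))

  -- The coefficients of x_p³, x_p² x_v (in two index orders), x_p x_v² and
  -- x_p x_v x_w: normalising the disjunction `isPerm` with the solver for (Bool, ∨)
  -- turns it into a test against the duplicate-free list of permutations.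
  monoCoeff-ppp : ∀ {m} (X : CubicForm K m) p → monoCoeff K X p p p ≈ X p p p
  monoCoeff-ppp X p = trans (monoCoeff-as X p p p ((p , p , p) ∷ []) ([] ∷ [])
    (λ i j k → solve-∨ 1 (λ x → x ⊕ (x ⊕ (x ⊕ (x ⊕ (x ⊕ x)))) ⊜ x ⊕ id) ≡.refl (matches (p , p , p) i j k)))
    (+-identityʳ _)

  oneOther : ∀ {m} (p v : Fin m) → List (Triple m)
  oneOther p v = (v , p , p) ∷ (p , v , p) ∷ (p , p , v) ∷ []

  oneOther-distinct : ∀ {m} {p v : Fin m} → v ≢ p → Unique (oneOther p v)
  oneOther-distinct v≢p = (differ₁ v≢p ∷ differ₁ v≢p ∷ []) ∷ (differ₂ v≢p ∷ []) ∷ [] ∷ []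

  monoCoeff-ppv : ∀ {m} (X : CubicForm K m) p v → v ≢ p → monoCoeff K X p p v ≈ (X v p p + X p v p) + X p p v
  monoCoeff-ppv X p v v≢p = trans (monoCoeff-as X p p v (oneOther p v) (oneOther-distinct v≢p)
    (λ i j k → solve-∨ 3 (λ x y z → x ⊕ (y ⊕ (x ⊕ (y ⊕ (z ⊕ z)))) ⊜ z ⊕ (y ⊕ (x ⊕ id))) ≡.refl
                 (matches (p , p , v) i j k) (matches (p , v , p) i j k) (matches (v , p , p) i j k)))
    (nested₃ _ _ _)

  monoCoeff-pvp : ∀ {m} (X : CubicForm K m) p v → v ≢ p → monoCoeff K X p v p ≈ (X v p p + X p v p) + X p p v
  monoCoeff-pvp X p v v≢p = trans (monoCoeff-as X p v p (oneOther p v) (oneOther-distinct v≢p)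
    (λ i j k → solve-∨ 3 (λ x y z → x ⊕ (y ⊕ (z ⊕ (z ⊕ (y ⊕ x)))) ⊜ z ⊕ (x ⊕ (y ⊕ id))) ≡.refl
                 (matches (p , v , p) i j k) (matches (p , p , v) i j k) (matches (v , p , p) i j k)))
    (nested₃ _ _ _)

  monoCoeff-pvv : ∀ {m} (X : CubicForm K m) p v → v ≢ p → monoCoeff K X p v v ≈ (X p v v + X v p v) + X v v p
  monoCoeff-pvv X p v v≢p = trans (monoCoeff-as X p v v ((p , v , v) ∷ (v , p , v) ∷ (v , v , p) ∷ [])
    ((differ₁ p≢v ∷ differ₁ p≢v ∷ []) ∷ (differ₂ p≢v ∷ []) ∷ [] ∷ [])
    (λ i j k → solve-∨ 3 (λ x y z → x ⊕ (x ⊕ (y ⊕ (z ⊕ (y ⊕ z)))) ⊜ x ⊕ (y ⊕ (z ⊕ id))) ≡.refl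
                 (matches (p , v , v) i j k) (matches (v , p , v) i j k) (matches (v , v , p) i j k)))
    (nested₃ _ _ _)
    where
    p≢v : p ≢ v
    p≢v e = v≢p (≡.sym e)

  monoCoeff-pvw : ∀ {m} (X : CubicForm K m) p v w → p ≢ v → p ≢ w → v ≢ w →
    monoCoeff K X p v w ≈ X p v w + (X p w v + (X v p w + (X v w p + (X w p v + X w v p))))
  monoCoeff-pvw X p v w p≢v p≢w v≢w = trans (monoCoeff-as X p v w
    ((p , v , w) ∷ (p , w , v) ∷ (v , p , w) ∷ (v , w , p) ∷ (w , p , v) ∷ (w , v , p) ∷ [])
    ( (differ₂ v≢w ∷ differ₁ p≢v ∷ differ₁ p≢v ∷ differ₁ p≢w ∷ differ₁ p≢w ∷ [])
    ∷ (differ₁ p≢v ∷ differ₁ p≢v ∷ differ₁ p≢w ∷ differ₁ p≢w ∷ [])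
    ∷ (differ₂ p≢w ∷ differ₁ v≢w ∷ differ₁ v≢w ∷ [])
    ∷ (differ₁ v≢w ∷ differ₁ v≢w ∷ [])
    ∷ (differ₂ p≢v ∷ [])
    ∷ [] ∷ [])
    (λ i j k → ≡.cong (λ z → matches (p , v , w) i j k ∨ (matches (p , w , v) i j k ∨ (matches (v , p , w) i j k
                        ∨ (matches (v , w , p) i j k ∨ (matches (w , p , v) i j k ∨ z)))))
                      (≡.sym (∨-identityʳ (matches (w , v , p) i j k)))))
    (+-congˡ (+-congˡ (+-congˡ (+-congˡ (+-congˡ (+-identityʳ _))))))

  absent : ∀ {m} (X : CubicForm K m) p →
    X p p p ≈ 0# →
    (∀ v → (X v p p + X p v p) + X p p v ≈ 0#) →
    (∀ v → (X p v v + X v p v) + X v v p ≈ 0#) →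
    (∀ v w → X p v w + (X p w v + (X v p w + (X v w p + (X w p v + X w v p)))) ≈ 0#) →
    ¬ Appears K X p
  absent X p ppp≈0 ppv≈0 pvv≈0 pvw≈0 (b , d , coeff≉0) = coeff≉0 (vanishes b d)
    where
    vanishes : ∀ b d → monoCoeff K X p b d ≈ 0#
    vanishes b d with b Fin.≟ p | d Fin.≟ p | b Fin.≟ d
    ... | yes ≡.refl | yes ≡.refl | _          = trans (monoCoeff-ppp X p) ppp≈0
    ... | yes ≡.refl | no d≢p     | _          = trans (monoCoeff-ppv X p d d≢p) (ppv≈0 d)
    ... | no b≢p     | yes ≡.refl | _          = trans (monoCoeff-pvp X p b b≢p) (ppv≈0 b)
    ... | no b≢p     | no _       | yes ≡.refl = trans (monoCoeff-pvv X p b b≢p) (pvv≈0 b)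
    ... | no b≢p     | no d≢p     | no b≢d     =
      trans (monoCoeff-pvw X p b d (λ e → b≢p (≡.sym e)) (λ e → d≢p (≡.sym e)) b≢d) (pvw≈0 b d)

  fewer-variables : ∀ {m} (X : CubicForm K m) p → ¬ Appears K X p → numVars K X < m
  fewer-variables {m} X p p-absent =
    ≡.subst (numVars K X <_) (length-tabulate {n = m} (λ i → i))
      (filter-notAll (appears? K X) (allFin m) (Any.map (λ { ≡.refl → p-absent }) (∈-allFin p)))

module RankOne (K : FiniteField) {m : ℕ} (p : Fin m) where
  open FiniteField K hiding (zero)
  open import Relation.Binary.Reasoning.Setoid setoid
  open import Algebra.Solver.Ring.NaturalCoefficients.Default commutativeSemiring
  open import Algebra.Properties.Ring ring using (-‿distribˡ-*)
  open Sums K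

  E : (Fin m → Carrier) → Matrix K m
  E u i j = I K i j + u i * I K j p

  -- (I + u e_pᵀ)(I + w e_pᵀ) = I + (u + w + w_p u) e_pᵀ.
  E-product : ∀ u w → (∀ i → u i + (w i + u i * w p) ≈ 0#) →
    ∀ i j → ΣF (λ k → E u i k * E w k j) ≈ I K i j
  E-product u w cancels i j = begin
    ΣF (λ k → E u i k * E w k j)
      ≈⟨ ΣF-cong (λ k → trans (*-congʳ (+-congˡ (*-congˡ (I-sym k p))))
           (solve 6 (λ Iik Ipk Ikj Ijp ui wk →
               (Iik :+ ui :* Ipk) :* (Ikj :+ wk :* Ijp)
            := Iik :* Ikj :+ (Ijp :* (Iik :* wk) :+ (ui :* (Ipk :* Ikj) :+ (ui :* Ijp) :* (Ipk :* wk))))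
            refl (I K i k) (I K p k) (I K k j) (I K j p) (u i) (w k))) ⟩
    ΣF (λ k → I K i k * I K k j + (I K j p * (I K i k * w k) + (u i * (I K p k * I K k j) + (u i * I K j p) * (I K p k * w k))))
      ≈⟨ trans (ΣF-+ {m} _ _) (+-congˡ (trans (ΣF-+ {m} _ _) (+-congˡ (ΣF-+ {m} _ _)))) ⟩
    ΣF (λ k → I K i k * I K k j) + (ΣF (λ k → I K j p * (I K i k * w k))
      + (ΣF (λ k → u i * (I K p k * I K k j)) + ΣF (λ k → (u i * I K j p) * (I K p k * w k))))
      ≈⟨ +-cong (ΣF-δ i (λ k → I K k j))
           (+-cong (trans (ΣF-* {m} _ _) (*-congˡ (ΣF-δ i w)))
             (+-cong (trans (ΣF-* {m} _ _) (*-congˡ (trans (ΣF-δ p (λ k → I K k j)) (I-sym p j))))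
                     (trans (ΣF-* {m} _ _) (*-congˡ (ΣF-δ p w))))) ⟩
    I K i j + (I K j p * w i + (u i * I K j p + (u i * I K j p) * w p))
      ≈⟨ solve 5 (λ Iij Ijp wi ui wp → Iij :+ (Ijp :* wi :+ (ui :* Ijp :+ (ui :* Ijp) :* wp))
                                   := Iij :+ (ui :+ (wi :+ ui :* wp)) :* Ijp) refl (I K i j) (I K j p) (w i) (u i) (w p) ⟩
    I K i j + (u i + (w i + u i * w p)) * I K j p
      ≈⟨ +-congˡ (trans (*-congʳ (cancels i)) (zeroˡ _)) ⟩
    I K i j + 0#
      ≈⟨ +-identityʳ _ ⟩
    I K i j ∎

  -- With u = a - e_p and v = -a_p⁻¹ u, the matrices E u and E v are
  -- mutually inverse, and the p-th column of E u is a.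
  with-column : ∀ (a : Fin m → Carrier) → ¬ a p ≈ 0# → Σ (Matrix K m) λ τ → Invertible K τ × (∀ i → τ i p ≈ a i)
  with-column a ap≉0 with inverse (a p) ap≉0
  ... | a⁻¹ , aa⁻¹≈1 = E u , (E v , E-product v u v-u , E-product u v u-v) , column
    where
    u v : Fin m → Carrier
    u i = a i + - I K i p
    n : Carrier
    n = - a⁻¹
    v i = u i * n

    1+up≈ap : 1# + u p ≈ a p
    1+up≈ap = begin
      1# + (a p + - I K p p) ≈⟨ +-congˡ (+-congˡ (-‿cong (I-diag p))) ⟩
      1# + (a p + - 1#)      ≈⟨ solve 3 (λ o x y → o :+ (x :+ y) := x :+ (o :+ y)) refl 1# (a p) (- 1#) ⟩
      a p + (1# + - 1#)      ≈⟨ +-congˡ (-‿inverseʳ 1#) ⟩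
      a p + 0#               ≈⟨ +-identityʳ _ ⟩
      a p                    ∎

    key : 1# + n * (1# + u p) ≈ 0#
    key = begin
      1# + n * (1# + u p)  ≈⟨ +-congˡ (*-congˡ 1+up≈ap) ⟩
      1# + - a⁻¹ * a p     ≈⟨ +-congˡ (-‿distribˡ-* a⁻¹ (a p)) ⟨
      1# + - (a⁻¹ * a p)   ≈⟨ +-congˡ (-‿cong (trans (*-comm a⁻¹ (a p)) aa⁻¹≈1)) ⟩
      1# + - 1#            ≈⟨ -‿inverseʳ 1# ⟩
      0#                   ∎

    v-u : ∀ i → v i + (u i + v i * u p) ≈ 0#
    v-u i = trans (solve 3 (λ x y z → x :* y :+ (x :+ (x :* y) :* z) := x :* (con 1 :+ y :* (con 1 :+ z))) refl (u i) n (u p))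
                  (trans (*-congˡ key) (zeroʳ _))

    u-v : ∀ i → u i + (v i + u i * v p) ≈ 0#
    u-v i = trans (solve 3 (λ x y z → x :+ (x :* y :+ x :* (z :* y)) := x :* (con 1 :+ y :* (con 1 :+ z))) refl (u i) n (u p))
                  (trans (*-congˡ key) (zeroʳ _))

    column : ∀ i → E u i p ≈ a i
    column i = begin
      I K i p + (a i + - I K i p) * I K p p ≈⟨ +-congˡ (*-congˡ (I-diag p)) ⟩
      I K i p + (a i + - I K i p) * 1#      ≈⟨ solve 3 (λ e x y → e :+ (x :+ y) :* con 1 := x :+ (e :+ y)) refl (I K i p) (a i) (- I K i p) ⟩
      a i + (I K i p + - I K i p)           ≈⟨ +-congˡ (-‿inverseʳ _) ⟩
      a i + 0#                              ≈⟨ +-identityʳ _ ⟩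
      a i                                   ∎

module Degeneracy (K : FiniteField) {m : ℕ} (c : CubicForm K m) where
  open FiniteField K hiding (zero)
  open import Relation.Binary.Reasoning.Setoid setoid
  open CubicCalculus K c
  open MonomialCoefficients K using (absent; fewer-variables)

  module _ (a : Point) (Fa≈0 : F a ≈ 0#) (a-singular : ∀ y → D a y ≈ 0#) (polar≈0 : ∀ v → D v a ≈ 0#) where

    -- After a change of variables τ whose p-th column is a, the variable x_p is absent:
    -- the coefficients of F(τ x) are T(τ_u, τ_v, τ_w) for the columns τ_u of τ, and
    -- those involving τ_p = a are the symmetric sums killed by the hypotheses on a.
    absent-after : ∀ (τ : Matrix K m) p → (∀ i → τ i p ≈ a i) → ¬ Appears K (substF K τ c) p
    absent-after τ p τp≈a = absent c′ p ppp≈0 ppv≈0 pvv≈0 pvw≈0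
      where
      c′ : CubicForm K m
      c′ = substF K τ c
      col : Fin m → Point
      col j i = τ i j
      same : ∀ {x : Point} i → x i ≈ x i
      same i = refl
      ppp≈0 : c′ p p p ≈ 0#
      ppp≈0 = trans (T-cong τp≈a τp≈a τp≈a) Fa≈0
      ppv≈0 : ∀ v → (c′ v p p + c′ p v p) + c′ p p v ≈ 0#
      ppv≈0 v = begin
        (T (col v) (col p) (col p) + T (col p) (col v) (col p)) + T (col p) (col p) (col v)
          ≈⟨ +-cong (+-cong (T-cong same τp≈a τp≈a) (T-cong τp≈a same τp≈a)) (T-cong τp≈a τp≈a same) ⟩
        (T (col v) a a + T a (col v) a) + T a a (col v) ≈⟨ D-T a (col v) ⟨
        D a (col v)                                      ≈⟨ a-singular (col v) ⟩
        0#                                               ∎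
      pvv≈0 : ∀ v → (c′ p v v + c′ v p v) + c′ v v p ≈ 0#
      pvv≈0 v = begin
        (T (col p) (col v) (col v) + T (col v) (col p) (col v)) + T (col v) (col v) (col p)
          ≈⟨ +-cong (+-cong (T-cong τp≈a same same) (T-cong same τp≈a same)) (T-cong same same τp≈a) ⟩
        (T a (col v) (col v) + T (col v) a (col v)) + T (col v) (col v) a ≈⟨ D-T (col v) a ⟨
        D (col v) a                                                      ≈⟨ polar≈0 (col v) ⟩
        0#                                                               ∎
      pvw≈0 : ∀ v w → c′ p v w + (c′ p w v + (c′ v p w + (c′ v w p + (c′ w p v + c′ w v p)))) ≈ 0#
      pvw≈0 v w = trans
        (+-cong (T-cong τp≈a same same) (+-cong (T-cong τp≈a same same) (+-cong (T-cong same τp≈a same)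
          (+-cong (T-cong same same τp≈a) (+-cong (T-cong same τp≈a same) (T-cong same same τp≈a))))))
        (Six-vanishes a polar≈0 (col v) (col w))

    -- Moving a non-zero such a to a coordinate axis shows that F has order < m.
    degenerate : ¬ IsZero a → ¬ NonDegenerate K c
    degenerate a≉0 (_ , minimal) =
      let p , ap≉0 = FinP.¬∀⟶∃¬ m (λ i → a i ≈ 0#) (λ i → a i ≟ 0#) a≉0
          τ , τ-invertible , τp≈a = RankOne.with-column K p a ap≉0
      in ℕP.<⇒≱ (fewer-variables (substF K τ c) p (absent-after τ p τp≈a)) (minimal τ τ-invertible)

⊎-all : ∀ {n} {A : Set} {P : Fin n → Set} → (∀ i → A ⊎ P i) → A ⊎ (∀ i → P i)
⊎-all {zero} f = inj₂ (λ ())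
⊎-all {suc n} f with f zero | ⊎-all (λ i → f (suc i))
... | inj₁ a  | _        = inj₁ a
... | inj₂ _  | inj₁ a   = inj₁ a
... | inj₂ p₀ | inj₂ pₛ  = inj₂ λ { zero → p₀ ; (suc i) → pₛ i }

module FieldSums (K : FiniteField) where
  open FiniteField K hiding (zero)
  open import Relation.Binary.Reasoning.Setoid setoid
  open import Data.Fin.Permutation using (Permutation; permutation)
  open Sums K

  record Enumeration : Set where
    field
      card : ℕ
      enum : Fin card → Carrier
      enum-injective : ∀ i j → enum i ≈ enum j → i ≡ j

  enumerate : (xs : List Carrier) →
    Σ Enumeration λ E → ∀ y → Any (y ≈_) xs → ∃ λ i → Enumeration.enum E i ≈ y
  enumerate [] = record { card = 0 ; enum = λ () ; enum-injective = λ () } , λ _ ()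
  enumerate (x ∷ xs) with enumerate xs
  ... | E , covers with FinP.any? (λ i → Enumeration.enum E i ≟ x)
  ...   | yes (i , eᵢ≈x) = E , covers′
    where
    covers′ : ∀ y → Any (y ≈_) (x ∷ xs) → ∃ λ i → Enumeration.enum E i ≈ y
    covers′ y (here y≈x) = i , trans eᵢ≈x (sym y≈x)
    covers′ y (there y∈xs) = covers y y∈xs
  ...   | no x∉E = E′ , covers′
    where
    open Enumeration E
    enum′ : Fin (suc card) → Carrier
    enum′ zero = x
    enum′ (suc i) = enum i
    injective′ : ∀ i j → enum′ i ≈ enum′ j → i ≡ j
    injective′ zero zero _ = ≡.refl
    injective′ zero (suc j) x≈eⱼ = ⊥-elim (x∉E (j , sym x≈eⱼ))
    injective′ (suc i) zero eᵢ≈x = ⊥-elim (x∉E (i , eᵢ≈x))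
    injective′ (suc i) (suc j) eᵢ≈eⱼ = ≡.cong suc (enum-injective i j eᵢ≈eⱼ)
    E′ : Enumeration
    E′ = record { card = suc card ; enum = enum′ ; enum-injective = injective′ }
    covers′ : ∀ y → Any (y ≈_) (x ∷ xs) → ∃ λ i → enum′ i ≈ y
    covers′ y (here y≈x) = zero , sym y≈x
    covers′ y (there y∈xs) with covers y y∈xs
    ... | i , eᵢ≈y = suc i , eᵢ≈y

  open Enumeration (proj₁ (enumerate elements)) public

  idx : Carrier → Fin card
  idx y = proj₁ (proj₂ (enumerate elements) y (complete y))

  enum-idx : ∀ y → enum (idx y) ≈ y
  enum-idx y = proj₂ (proj₂ (enumerate elements) y (complete y))

  idx-cong : ∀ {x y} → x ≈ y → idx x ≡ idx y
  idx-cong {x} {y} x≈y = enum-injective _ _ (trans (enum-idx x) (trans x≈y (sym (enum-idx y))))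

  idx-enum : ∀ i → idx (enum i) ≡ i
  idx-enum i = enum-injective _ _ (enum-idx (enum i))

  ΣK : (Carrier → Carrier) → Carrier
  ΣK f = ΣF (λ i → f (enum i))

  ΣK-cong : ∀ {f g} → (∀ t → f t ≈ g t) → ΣK f ≈ ΣK g
  ΣK-cong f≈g = ΣF-cong (λ i → f≈g (enum i))

  Congruent : (Carrier → Carrier) → Set
  Congruent f = ∀ {x y} → x ≈ y → f x ≈ f y

  ΣK-bijection : ∀ g h → Congruent g → Congruent h → (∀ x → g (h x) ≈ x) → (∀ x → h (g x) ≈ x) →
    ∀ f → Congruent f → ΣK (λ t → f (g t)) ≈ ΣK f
  ΣK-bijection g h g-cong h-cong gh hg f f-cong = begin
    ΣF (λ i → f (g (enum i)))   ≈⟨ ΣF-cong (λ i → f-cong (sym (enum-idx (g (enum i))))) ⟩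
    ΣF (λ i → f (enum (ĝ i)))   ≈⟨ ΣF-permute (λ i → f (enum i)) π ⟨
    ΣF (λ i → f (enum i))       ∎
    where
    ĝ ĥ : Fin card → Fin card
    ĝ i = idx (g (enum i))
    ĥ i = idx (h (enum i))
    π : Permutation card card
    π = permutation ĝ ĥ
      (λ i → ≡.trans (idx-cong (trans (g-cong (enum-idx (h (enum i)))) (gh (enum i)))) (idx-enum i))
      (λ i → ≡.trans (idx-cong (trans (h-cong (enum-idx (g (enum i)))) (hg (enum i)))) (idx-enum i))

  cons : ∀ {m} → Carrier → (Fin m → Carrier) → Fin (suc m) → Carrier
  cons t x zero = t
  cons t x (suc i) = x i

  ΣV : ∀ {m} → ((Fin m → Carrier) → Carrier) → Carrier
  ΣV {zero} f = f (λ ())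
  ΣV {suc m} f = ΣK (λ t → ΣV (λ x → f (cons t x)))

  ΣV-cong : ∀ {m} {f g : (Fin m → Carrier) → Carrier} → (∀ x → f x ≈ g x) → ΣV f ≈ ΣV g
  ΣV-cong {zero} f≈g = f≈g _
  ΣV-cong {suc m} f≈g = ΣK-cong (λ t → ΣV-cong (λ x → f≈g (cons t x)))

  ΣV-+ : ∀ {m} (f g : (Fin m → Carrier) → Carrier) → ΣV (λ x → f x + g x) ≈ ΣV f + ΣV g
  ΣV-+ {zero} f g = refl
  ΣV-+ {suc m} f g = trans (ΣK-cong (λ t → ΣV-+ (λ x → f (cons t x)) (λ x → g (cons t x))))
    (ΣF-+ (λ i → ΣV (λ x → f (cons (enum i) x))) (λ i → ΣV λ x → g (cons (enum i) x)))

  ΣV-* : ∀ {m} a (f : (Fin m → Carrier) → Carrier) → ΣV (λ x → a * f x) ≈ a * ΣV f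
  ΣV-* {zero} a f = refl
  ΣV-* {suc m} a f = trans (ΣK-cong (λ t → ΣV-* a (λ x → f (cons t x))))
    (ΣF-* a (λ i → ΣV (λ x → f (cons (enum i) x))))

  ΣV-zero : ∀ {m} → ΣV {m} (λ _ → 0#) ≈ 0#
  ΣV-zero {zero} = refl
  ΣV-zero {suc m} = trans (ΣK-cong (λ _ → ΣV-zero {m})) (ΣF-zero {card} (λ _ → refl))

  search-from : ∀ {m} (P : (Fin (suc m) → Carrier) → Set) → (∀ {x y} → (∀ i → x i ≈ y i) → P x → P y) →
    (∀ x → Dec (P x)) → ∀ t → Σ (Fin (suc m) → Carrier) P ⊎ (∀ x → ¬ P (cons t x))
  search : ∀ {m} (P : (Fin m → Carrier) → Set) → (∀ {x y} → (∀ i → x i ≈ y i) → P x → P y) →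
    (∀ x → Dec (P x)) → Σ (Fin m → Carrier) P ⊎ (∀ x → ¬ P x)
  search {zero} P resp P? with P? (λ ())
  ... | yes p = inj₁ (_ , p)
  ... | no ¬p = inj₂ (λ x px → ¬p (resp (λ ()) px))
  search {suc m} P resp P? with ⊎-all (λ i → search-from P resp P? (enum i))
  ... | inj₁ found = inj₁ found
  ... | inj₂ none = inj₂ λ x px → none (idx (x zero)) (λ i → x (suc i))
                      (resp (λ { zero → sym (enum-idx (x zero)) ; (suc i) → refl }) px)

  search-from P resp P? t with search (λ x → P (cons t x))
                                 (λ x≈y → resp (λ { zero → refl ; (suc i) → x≈y i })) (λ x → P? (cons t x))
  ... | inj₁ (x , px) = inj₁ (cons t x , px)
  ... | inj₂ none = inj₂ none

minimise : (P : ℕ → Set) → (∀ n → Dec (P n)) → ∀ b → P b → Σ ℕ λ n → P n × (∀ k → k < n → ¬ P k)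
minimise P P? b pb with below (suc b)
  where
  below : ∀ b → (∀ k → k < b → ¬ P k) ⊎ (Σ ℕ λ n → P n × (∀ k → k < n → ¬ P k))
  below zero = inj₁ (λ k ())
  below (suc b) with below b
  ... | inj₂ least = inj₂ least
  ... | inj₁ none with P? b
  ...   | yes pb = inj₂ (b , pb , none)
  ...   | no ¬pb = inj₁ (λ k k<sb → [ none k , (λ { ≡.refl → ¬pb }) ]′ (ℕP.m<1+n⇒m<n∨m≡n k<sb))
... | inj₁ none = ⊥-elim (none b (ℕP.n<1+n b) pb)
... | inj₂ least = least

-- Power sums: for the least N > 0 with t^N = 1 for all t ≠ 0,
-- Σ_{t ∈ K} t^k = 0 for every k < N.

module PowerSums (K : FiniteField) where
  open FiniteField K hiding (zero)
  open import Relation.Binary.Reasoning.Setoid setoid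
  open import Algebra.Properties.Semiring.Exp semiring public using (_^_; ^-congˡ; ^-homo-*; ^-assocʳ)
  open import Algebra.Properties.CommutativeSemiring.Exp commutativeSemiring public using (^-distrib-*)
  open import Algebra.Properties.Group +-group using (identityʳ-unique)
  open Sums K
  open FieldFacts K
  open FieldSums K

  1^n≈1 : ∀ n → 1# ^ n ≈ 1#
  1^n≈1 zero = refl
  1^n≈1 (suc n) = trans (*-identityˡ _) (1^n≈1 n)

  ^-nonzero : ∀ {x} n → ¬ x ≈ 0# → ¬ x ^ n ≈ 0#
  ^-nonzero zero x≉0 = 1≉0
  ^-nonzero (suc n) x≉0 = *-nonzero x≉0 (^-nonzero n x≉0)

  -- By the pigeonhole principle, every t ≠ 0 has a multiplicative order ≤ |K|.
  order : ∀ t → ¬ t ≈ 0# → ∃ λ k → suc k ≤ card × t ^ suc k ≈ 1#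
  order t t≉0 with FinP.pigeonhole (ℕP.n<1+n card) (λ (i : Fin (suc card)) → idx (t ^ Fin.toℕ i))
  ... | i , j , i<j , same-power with ℕP.m≤n⇒∃[o]m+o≡n i<j
  ... | o , i+1+o≡j = o , o<j , *-cancelˡ (^-nonzero (Fin.toℕ i) t≉0) (begin
      t ^ Fin.toℕ i * t ^ suc o   ≈⟨ ^-homo-* t (Fin.toℕ i) (suc o) ⟨
      t ^ (Fin.toℕ i ℕ.+ suc o)   ≡⟨ ≡.cong (t ^_) (≡.trans (ℕP.+-suc (Fin.toℕ i) o) i+1+o≡j) ⟩
      t ^ Fin.toℕ j               ≈⟨ enum-idx _ ⟨
      enum (idx (t ^ Fin.toℕ j))  ≡⟨ ≡.cong enum same-power ⟨
      enum (idx (t ^ Fin.toℕ i))  ≈⟨ enum-idx _ ⟩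
      t ^ Fin.toℕ i               ≈⟨ *-identityʳ _ ⟨
      t ^ Fin.toℕ i * 1#          ∎)
    where
    o<j : suc o ≤ card
    o<j = ℕP.≤-trans (s≤s (ℕP.m≤n+m o (Fin.toℕ i)))
            (≡.subst (_≤ card) (≡.sym i+1+o≡j) (ℕP.≤-pred (FinP.toℕ<n j)))

  factorial-exponent : ∀ t → ¬ t ≈ 0# → t ^ (card ℕ.!) ≈ 1#
  factorial-exponent t t≉0 with order t t≉0
  ... | k , k<card , tᵏ≈1 with ∣-trans (m∣m*n {suc k} (k ℕ.!)) (m≤n⇒m!∣n! k<card)
  ... | divides q card!≡q*k = begin
    t ^ (card ℕ.!)          ≡⟨ ≡.cong (t ^_) (≡.trans card!≡q*k (ℕP.*-comm q (suc k))) ⟩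
    t ^ (suc k ℕ.* q)       ≈⟨ ^-assocʳ t (suc k) q ⟨
    (t ^ suc k) ^ q         ≈⟨ ^-congˡ q tᵏ≈1 ⟩
    1# ^ q                  ≈⟨ 1^n≈1 q ⟩
    1#                      ∎

  -- n is an exponent: t^n = 1 for all t ≠ 0 (checked on the enumeration, so decidable).
  Exponent : ℕ → Set
  Exponent n = ∀ i → ¬ enum i ≈ 0# → enum i ^ n ≈ 1#

  exponent? : ∀ n → Dec (0 < n × Exponent n)
  exponent? n = (0 ℕ.<? n) ×-dec FinP.all? (λ i → ¬? (enum i ≟ 0#) →-dec ((enum i ^ n) ≟ 1#))

  -- N is the least positive exponent; |K|! bounds the search.
  least-exponent : Σ ℕ λ N → (0 < N × Exponent N) × (∀ k → k < N → ¬ (0 < k × Exponent k))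
  least-exponent = minimise _ exponent? (card ℕ.!)
    (ℕ.>-nonZero⁻¹ (card ℕ.!) {{card ℕP.!≢0}} , λ i → factorial-exponent (enum i))

  N : ℕ
  N = proj₁ least-exponent

  0<N : 0 < N
  0<N = proj₁ (proj₁ (proj₂ least-exponent))

  fermat : ∀ t → ¬ t ≈ 0# → t ^ N ≈ 1#
  fermat t t≉0 = trans (^-congˡ N (sym (enum-idx t)))
    (proj₂ (proj₁ (proj₂ least-exponent)) (idx t) (λ e → t≉0 (trans (sym (enum-idx t)) e)))

  below-exponent : ∀ k → 0 < k → k < N → ∃ λ t → ¬ t ≈ 0# × ¬ t ^ k ≈ 1#
  below-exponent k 0<k k<N =
    let i , ¬implication = FinP.¬∀⟶∃¬ card (λ i → ¬ enum i ≈ 0# → enum i ^ k ≈ 1#)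
                             (λ i → ¬? (enum i ≟ 0#) →-dec ((enum i ^ k) ≟ 1#))
                             (λ exp → proj₂ (proj₂ least-exponent) k k<N (0<k , exp))
    in enum i , (λ eᵢ≈0 → ¬implication (λ eᵢ≉0 → ⊥-elim (eᵢ≉0 eᵢ≈0))) , (λ eᵢᵏ≈1 → ¬implication (λ _ → eᵢᵏ≈1))

  -- Translation t ↦ t + 1 permutes K, so Σ_t 1 = 0: the characteristic divides |K|.
  ΣK-one : ΣK (λ _ → 1#) ≈ 0#
  ΣK-one = identityʳ-unique (ΣK (λ t → t)) (ΣK (λ _ → 1#)) (begin
    ΣK (λ t → t) + ΣK (λ _ → 1#) ≈⟨ ΣF-+ (λ i → enum i) (λ _ → 1#) ⟨
    ΣK (λ t → t + 1#)            ≈⟨ ΣK-bijection (_+ 1#) (_+ - 1#) +-congʳ +-congʳ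
                                      (λ x → trans (+-assoc _ _ _) (trans (+-congˡ (-‿inverseˡ 1#)) (+-identityʳ x)))
                                      (λ x → trans (+-assoc _ _ _) (trans (+-congˡ (-‿inverseʳ 1#)) (+-identityʳ x)))
                                      (λ t → t) (λ x≈y → x≈y) ⟩
    ΣK (λ t → t)                 ∎)

  -- Multiplication by b ≠ 0 permutes K, so b^k Σ_t t^k = Σ_t t^k.
  ΣK-power-scaling : ∀ k b → ¬ b ≈ 0# → b ^ k * ΣK (λ t → t ^ k) ≈ ΣK (λ t → t ^ k)
  ΣK-power-scaling k b b≉0 = let b⁻¹ , bb⁻¹≈1 = inverse b b≉0 in begin
    b ^ k * ΣK (λ t → t ^ k)       ≈⟨ ΣF-* (b ^ k) (λ i → enum i ^ k) ⟨
    ΣK (λ t → b ^ k * t ^ k)       ≈⟨ ΣK-cong (λ t → ^-distrib-* b t k) ⟨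
    ΣK (λ t → (b * t) ^ k)         ≈⟨ ΣK-bijection (b *_) (b⁻¹ *_) *-congˡ *-congˡ
                                        (λ x → trans (sym (*-assoc _ _ _)) (trans (*-congʳ bb⁻¹≈1) (*-identityˡ x)))
                                        (λ x → trans (sym (*-assoc _ _ _)) (trans (*-congʳ (trans (*-comm b⁻¹ b) bb⁻¹≈1)) (*-identityˡ x)))
                                        (_^ k) (^-congˡ k) ⟩
    ΣK (λ t → t ^ k)               ∎

  power-sum : ∀ k → k < N → ΣK (λ t → t ^ k) ≈ 0#
  power-sum zero _ = ΣK-one
  power-sum k@(suc _) k<N =
    let b , b≉0 , bᵏ≉1 = below-exponent k (s≤s z≤n) k<N
    in decidable-stable (ΣK (λ t → t ^ k) ≟ 0#) λ S≉0 → bᵏ≉1 (*-cancelˡ S≉0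
         (trans (*-comm _ _) (trans (ΣK-power-scaling k b b≉0) (sym (*-identityʳ _)))))

module Polynomials (K : FiniteField) where
  open FiniteField K hiding (zero)
  open import Relation.Binary.Reasoning.Setoid setoid
  open import Algebra.Solver.Ring.NaturalCoefficients.Default commutativeSemiring
  open Sums K
  open FieldSums K
  open PowerSums K

  -- A monomial is a list of variable indices, with repetitions.
  monomial : ∀ {m} → List (Fin m) → (Fin m → Carrier) → Carrier
  monomial [] x = 1#
  monomial (i ∷ u) x = x i * monomial u x

  count₀ : ∀ {m} → List (Fin (suc m)) → ℕ
  count₀ [] = 0
  count₀ (zero ∷ u) = suc (count₀ u)
  count₀ (suc i ∷ u) = count₀ u

  others : ∀ {m} → List (Fin (suc m)) → List (Fin m)
  others [] = []
  others (zero ∷ u) = others u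
  others (suc i ∷ u) = i ∷ others u

  monomial-cons : ∀ {m} (u : List (Fin (suc m))) t x →
    monomial u (cons t x) ≈ t ^ count₀ u * monomial (others u) x
  monomial-cons [] t x = sym (*-identityˡ 1#)
  monomial-cons (zero ∷ u) t x = trans (*-congˡ (monomial-cons u t x)) (sym (*-assoc _ _ _))
  monomial-cons (suc i ∷ u) t x = trans (*-congˡ (monomial-cons u t x))
    (solve 3 (λ a b d → a :* (b :* d) := b :* (a :* d)) refl (x i) (t ^ count₀ u) (monomial (others u) x))

  length-split : ∀ {m} (u : List (Fin (suc m))) → length u ≡ count₀ u ℕ.+ length (others u)
  length-split [] = ≡.refl
  length-split (zero ∷ u) = ≡.cong suc (length-split u)
  length-split (suc i ∷ u) = ≡.trans (≡.cong suc (length-split u)) (≡.sym (ℕP.+-suc _ _))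

  -- A monomial of degree < m N has some variable with exponent < N, whose power sum vanishes.
  monomial-sum : ∀ m (u : List (Fin m)) → length u < m ℕ.* N → ΣV (monomial u) ≈ 0#
  monomial-sum (suc m) u deg< = begin
    ΣK (λ t → ΣV (λ x → monomial u (cons t x)))
      ≈⟨ ΣK-cong (λ t → trans (ΣV-cong (monomial-cons u t)) (ΣV-* (t ^ count₀ u) (monomial (others u)))) ⟩
    ΣK (λ t → t ^ count₀ u * S)  ≈⟨ ΣK-cong (λ t → *-comm (t ^ count₀ u) S) ⟩
    ΣK (λ t → S * t ^ count₀ u)  ≈⟨ ΣF-* S (λ i → enum i ^ count₀ u) ⟩
    S * ΣK (λ t → t ^ count₀ u)  ≈⟨ vanishes (count₀ u ℕ.<? N) ⟩
    0#                           ∎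
    where
    S : Carrier
    S = ΣV (monomial (others u))
    vanishes : Dec (count₀ u < N) → S * ΣK (λ t → t ^ count₀ u) ≈ 0#
    vanishes (yes c<N) = trans (*-congˡ (power-sum (count₀ u) c<N)) (zeroʳ _)
    vanishes (no c≮N) = trans (*-congʳ (monomial-sum m (others u) rest<)) (zeroˡ _)
      where
      rest< : length (others u) < m ℕ.* N
      rest< = ℕP.+-cancelˡ-< N (length (others u)) (m ℕ.* N)
                (ℕP.≤-<-trans (ℕP.+-monoˡ-≤ (length (others u)) (ℕP.≮⇒≥ c≮N))
                  (≡.subst (_< N ℕ.+ m ℕ.* N) (length-split u) deg<))

  Poly : ℕ → Set
  Poly m = List (Carrier × List (Fin m))

  evalP : ∀ {m} → Poly m → (Fin m → Carrier) → Carrier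
  evalP [] x = 0#
  evalP ((a , u) ∷ P) x = a * monomial u x + evalP P x

  Homogeneous : ∀ {m} → ℕ → Poly m → Set
  Homogeneous d P = All (λ au → length (proj₂ au) ≡ d) P

  monomial-cong : ∀ {m} (u : List (Fin m)) {x y} → (∀ i → x i ≈ y i) → monomial u x ≈ monomial u y
  monomial-cong [] x≈y = refl
  monomial-cong (i ∷ u) x≈y = *-cong (x≈y i) (monomial-cong u x≈y)

  evalP-cong : ∀ {m} (P : Poly m) {x y} → (∀ i → x i ≈ y i) → evalP P x ≈ evalP P y
  evalP-cong [] x≈y = refl
  evalP-cong ((a , u) ∷ P) x≈y = +-cong (*-congˡ (monomial-cong u x≈y)) (evalP-cong P x≈y)

  evalP-origin : ∀ {m d} (P : Poly m) → Homogeneous (suc d) P → ∀ x → (∀ i → x i ≈ 0#) → evalP P x ≈ 0#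
  evalP-origin [] [] x x≈0 = refl
  evalP-origin ((a , i ∷ u) ∷ P) (_ ∷ hom) x x≈0 = begin
    a * (x i * monomial u x) + evalP P x  ≈⟨ +-cong (*-congˡ (*-congʳ (x≈0 i))) (evalP-origin P hom x x≈0) ⟩
    a * (0# * monomial u x) + 0#          ≈⟨ trans (+-identityʳ _) (trans (*-congˡ (zeroˡ _)) (zeroʳ a)) ⟩
    0#                                    ∎

  monomial-++ : ∀ {m} (u v : List (Fin m)) x → monomial (u ++ v) x ≈ monomial u x * monomial v x
  monomial-++ [] v x = sym (*-identityˡ _)
  monomial-++ (i ∷ u) v x = trans (*-congˡ (monomial-++ u v x)) (sym (*-assoc _ _ _))

  evalP-++ : ∀ {m} (P Q : Poly m) x → evalP (P ++ Q) x ≈ evalP P x + evalP Q x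
  evalP-++ [] Q x = sym (+-identityˡ _)
  evalP-++ ((a , u) ∷ P) Q x = trans (+-congˡ (evalP-++ P Q x)) (sym (+-assoc _ _ _))

  scaleP : ∀ {m} → Carrier → List (Fin m) → Poly m → Poly m
  scaleP a u = map (λ bv → (a * proj₁ bv , u ++ proj₂ bv))

  evalP-scale : ∀ {m} a (u : List (Fin m)) Q x → evalP (scaleP a u Q) x ≈ (a * monomial u x) * evalP Q x
  evalP-scale a u [] x = sym (zeroʳ _)
  evalP-scale a u ((b , v) ∷ Q) x = begin
    (a * b) * monomial (u ++ v) x + evalP (scaleP a u Q) x
      ≈⟨ +-cong (*-congˡ (monomial-++ u v x)) (evalP-scale a u Q x) ⟩
    (a * b) * (monomial u x * monomial v x) + (a * monomial u x) * evalP Q x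
      ≈⟨ solve 5 (λ a b mu mv e → (a :* b) :* (mu :* mv) :+ (a :* mu) :* e := (a :* mu) :* (b :* mv :+ e))
                 refl a b (monomial u x) (monomial v x) (evalP Q x) ⟩
    (a * monomial u x) * (b * monomial v x + evalP Q x) ∎

  mulP : ∀ {m} → Poly m → Poly m → Poly m
  mulP [] Q = []
  mulP ((a , u) ∷ P) Q = scaleP a u Q ++ mulP P Q

  evalP-mul : ∀ {m} (P Q : Poly m) x → evalP (mulP P Q) x ≈ evalP P x * evalP Q x
  evalP-mul [] Q x = sym (zeroˡ _)
  evalP-mul ((a , u) ∷ P) Q x = begin
    evalP (scaleP a u Q ++ mulP P Q) x                   ≈⟨ evalP-++ (scaleP a u Q) (mulP P Q) x ⟩
    evalP (scaleP a u Q) x + evalP (mulP P Q) x          ≈⟨ +-cong (evalP-scale a u Q x) (evalP-mul P Q x) ⟩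
    (a * monomial u x) * evalP Q x + evalP P x * evalP Q x ≈⟨ distribʳ _ _ _ ⟨
    (a * monomial u x + evalP P x) * evalP Q x           ∎

  homogeneous-scale : ∀ {m d} a (u : List (Fin m)) Q → Homogeneous d Q →
    Homogeneous (length u ℕ.+ d) (scaleP a u Q)
  homogeneous-scale a u [] [] = []
  homogeneous-scale a u ((b , v) ∷ Q) (deg-v ∷ hom) =
    ≡.trans (length-++ u) (≡.cong (length u ℕ.+_) deg-v) ∷ homogeneous-scale a u Q hom

  homogeneous-mul : ∀ {m d e} (P Q : Poly m) → Homogeneous d P → Homogeneous e Q →
    Homogeneous (d ℕ.+ e) (mulP P Q)
  homogeneous-mul [] Q [] _ = []
  homogeneous-mul {e = e} ((a , u) ∷ P) Q (deg-u ∷ hom-P) hom-Q =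
    ++⁺ (≡.subst (λ l → Homogeneous (l ℕ.+ e) (scaleP a u Q)) deg-u (homogeneous-scale a u Q hom-Q))
        (homogeneous-mul P Q hom-P hom-Q)

  powP : ∀ {m} → Poly m → ℕ → Poly m
  powP P zero = (1# , []) ∷ []
  powP P (suc n) = mulP P (powP P n)

  evalP-pow : ∀ {m} (P : Poly m) n x → evalP (powP P n) x ≈ evalP P x ^ n
  evalP-pow P zero x = trans (+-identityʳ _) (*-identityʳ 1#)
  evalP-pow P (suc n) x = trans (evalP-mul P (powP P n) x) (*-congˡ (evalP-pow P n x))

  homogeneous-pow : ∀ {m d} (P : Poly m) n → Homogeneous d P → Homogeneous (n ℕ.* d) (powP P n)
  homogeneous-pow P zero hom = ≡.refl ∷ []
  homogeneous-pow P (suc n) hom = homogeneous-mul P (powP P n) hom (homogeneous-pow P n hom)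

  ΣP : ∀ {n m} → (Fin n → Poly m) → Poly m
  ΣP {zero} f = []
  ΣP {suc n} f = f zero ++ ΣP (λ i → f (suc i))

  evalP-ΣP : ∀ {n m} (f : Fin n → Poly m) x → evalP (ΣP f) x ≈ ΣF (λ i → evalP (f i) x)
  evalP-ΣP {zero} f x = refl
  evalP-ΣP {suc n} f x = trans (evalP-++ (f zero) (ΣP (λ i → f (suc i))) x) (+-congˡ (evalP-ΣP (λ i → f (suc i)) x))

  homogeneous-ΣP : ∀ {n m d} (f : Fin n → Poly m) → (∀ i → Homogeneous d (f i)) → Homogeneous d (ΣP f)
  homogeneous-ΣP {zero} f hom = []
  homogeneous-ΣP {suc n} f hom = ++⁺ (hom zero) (homogeneous-ΣP (λ i → f (suc i)) (λ i → hom (suc i)))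

  polynomial-sum : ∀ {m d} (P : Poly m) → Homogeneous d P → d < m ℕ.* N → ΣV (evalP P) ≈ 0#
  polynomial-sum {m} [] [] _ = ΣV-zero {m}
  polynomial-sum {m} ((a , u) ∷ P) (deg-u ∷ hom) deg< = begin
    ΣV (λ x → a * monomial u x + evalP P x)       ≈⟨ ΣV-+ (λ x → a * monomial u x) (evalP P) ⟩
    ΣV (λ x → a * monomial u x) + ΣV (evalP P)    ≈⟨ +-cong (ΣV-* a (monomial u)) (polynomial-sum P hom deg<) ⟩
    a * ΣV (monomial u) + 0#                      ≈⟨ +-congʳ (*-congˡ (monomial-sum m u (≡.subst (_< m ℕ.* N) (≡.sym deg-u) deg<))) ⟩
    a * 0# + 0#                                   ≈⟨ trans (+-identityʳ _) (zeroʳ a) ⟩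
    0#                                            ∎

module ChevalleyWarning (K : FiniteField) where
  open FiniteField K hiding (zero)
  open import Relation.Binary.Reasoning.Setoid setoid
  open Sums K
  open FieldFacts K
  open FieldSums K
  open import Algebra.Properties.Ring ring using (-1*x≈-x)
  open PowerSums K
  open Polynomials K

  origin : ∀ {m} → (Fin m → Carrier) → Carrier
  origin x = if ⌊ FinP.all? (λ i → x i ≟ 0#) ⌋ then 1# else 0#

  origin-yes : ∀ {m} (x : Fin m → Carrier) → (∀ i → x i ≈ 0#) → origin x ≈ 1#
  origin-yes x x≈0 with FinP.all? (λ i → x i ≟ 0#)
  ... | yes _ = refl
  ... | no x≉0 = ⊥-elim (x≉0 x≈0)

  origin-no : ∀ {m} (x : Fin m → Carrier) → ¬ (∀ i → x i ≈ 0#) → origin x ≈ 0#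
  origin-no x x≉0 with FinP.all? (λ i → x i ≟ 0#)
  ... | yes x≈0 = ⊥-elim (x≉0 x≈0)
  ... | no _ = refl

  indicator₀ : Carrier → Carrier
  indicator₀ t = origin (λ (_ : Fin 1) → t)

  origin-cons : ∀ {m} t (x : Fin m → Carrier) → origin (cons t x) ≈ indicator₀ t * origin x
  origin-cons t x = by-cases (t ≟ 0#) (FinP.all? (λ i → x i ≟ 0#))
    where
    by-cases : Dec (t ≈ 0#) → Dec (∀ i → x i ≈ 0#) → origin (cons t x) ≈ indicator₀ t * origin x
    by-cases (yes t≈0) (yes x≈0) = trans (origin-yes (cons t x) (λ { zero → t≈0 ; (suc i) → x≈0 i }))
      (sym (trans (*-cong (origin-yes _ (λ _ → t≈0)) (origin-yes x x≈0)) (*-identityˡ 1#)))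
    by-cases (yes _)   (no x≉0)  = trans (origin-no (cons t x) (λ h → x≉0 (λ i → h (suc i))))
      (sym (trans (*-congˡ (origin-no x x≉0)) (zeroʳ _)))
    by-cases (no t≉0)  _         = trans (origin-no (cons t x) (λ h → t≉0 (h zero)))
      (sym (trans (*-congʳ (origin-no _ (λ h → t≉0 (h zero)))) (zeroˡ _)))

  ΣV-origin : ∀ {m} → ΣV {m} origin ≈ 1#
  ΣV-origin {zero} = origin-yes {0} (λ ()) (λ ())
  ΣV-origin {suc m} = begin
    ΣK (λ t → ΣV {m} (λ x → origin (cons t x)))  ≈⟨ ΣK-cong (λ t → trans (ΣV-cong {m} (origin-cons t)) (ΣV-* {m} (indicator₀ t) origin)) ⟩
    ΣK (λ t → indicator₀ t * ΣV {m} origin)  ≈⟨ ΣK-cong {g = indicator₀} (λ t → trans (*-congˡ (ΣV-origin {m})) (*-identityʳ _)) ⟩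
    ΣK indicator₀                            ≈⟨ ΣF-select (idx 0#) (λ i → indicator₀ (enum i)) off ⟩
    indicator₀ (enum (idx 0#))               ≈⟨ origin-yes _ (λ _ → enum-idx 0#) ⟩
    1#                                       ∎
    where
    off : ∀ i → i ≢ idx 0# → indicator₀ (enum i) ≈ 0#
    off i i≢idx0 = origin-no _ (λ eᵢ≈0 → i≢idx0 (enum-injective _ _ (trans (eᵢ≈0 zero) (sym (enum-idx 0#)))))

  NontrivialZero : ∀ {m} → Poly m → (Fin m → Carrier) → Set
  NontrivialZero P x = ¬ (∀ i → x i ≈ 0#) × evalP P x ≈ 0#

  -- Without non-trivial zeros, Fermat's little theorem makes P(x)^N = 1 - [x = 0].
  power-indicator : ∀ {m d} (P : Poly m) → Homogeneous (suc d) P → (∀ x → ¬ NontrivialZero P x) →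
    ∀ x → evalP P x ^ N ≈ 1# + - 1# * origin x
  power-indicator P hom no-zero x = by-cases (FinP.all? (λ i → x i ≟ 0#))
    where
    by-cases : Dec (∀ i → x i ≈ 0#) → evalP P x ^ N ≈ 1# + - 1# * origin x
    by-cases (yes x≈0) = begin
      evalP P x ^ N          ≈⟨ ^-congˡ N (evalP-origin P hom x x≈0) ⟩
      0# ^ N                 ≈⟨ zero^N 0<N ⟩
      0#                     ≈⟨ -‿inverseʳ 1# ⟨
      1# + - 1#              ≈⟨ +-congˡ (trans (*-congˡ (origin-yes x x≈0)) (*-identityʳ _)) ⟨
      1# + - 1# * origin x   ∎
      where
      zero^N : ∀ {n} → 0 < n → 0# ^ n ≈ 0#
      zero^N {suc n} _ = zeroˡ _
    by-cases (no x≉0) = begin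
      evalP P x ^ N          ≈⟨ fermat _ (λ Px≈0 → no-zero x (x≉0 , Px≈0)) ⟩
      1#                     ≈⟨ +-identityʳ 1# ⟨
      1# + 0#                ≈⟨ +-congˡ (trans (*-congˡ (origin-no x x≉0)) (zeroʳ _)) ⟨
      1# + - 1# * origin x   ∎

  chevalley-warning : ∀ {m d} (P : Poly m) → Homogeneous (suc d) P → suc d < m →
    Σ (Fin m → Carrier) (NontrivialZero P)
  chevalley-warning {m} {d} P hom d<m =
    fromInj₁ (λ no-zero → ⊥-elim (-‿nonzero 1≉0 (-1≈0 no-zero))) (search (NontrivialZero P) resp decide)
    where
    resp : ∀ {x y} → (∀ i → x i ≈ y i) → NontrivialZero P x → NontrivialZero P y
    resp x≈y (x≉0 , Px≈0) = (λ y≈0 → x≉0 (λ i → trans (x≈y i) (y≈0 i))) , trans (sym (evalP-cong P x≈y)) Px≈0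
    decide : ∀ x → Dec (NontrivialZero P x)
    decide x = ¬? (FinP.all? (λ i → x i ≟ 0#)) ×-dec (evalP P x ≟ 0#)
    ΣV-one : ΣV {m} (λ _ → 1#) ≈ 0#
    ΣV-one = monomial-sum m [] (ℕP.*-mono-≤ {1} {m} {1} {N} (ℕP.≤-trans (s≤s z≤n) d<m) 0<N)
    degree< : N ℕ.* suc d < m ℕ.* N
    degree< = ≡.subst (N ℕ.* suc d <_) (ℕP.*-comm N m) (ℕP.*-monoʳ-< N {{ℕ.>-nonZero 0<N}} d<m)
    -- summing P(x)^N over K^m in two ways
    -1≈0 : (∀ x → ¬ NontrivialZero P x) → - 1# ≈ 0#
    -1≈0 no-zero = begin
      - 1#                                       ≈⟨ -1*x≈-x 1# ⟨
      - 1# * 1#                                  ≈⟨ +-identityˡ _ ⟨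
      0# + - 1# * 1#                             ≈⟨ +-cong ΣV-one (*-congˡ (ΣV-origin {m})) ⟨
      ΣV {m} (λ _ → 1#) + - 1# * ΣV {m} origin           ≈⟨ +-congˡ (ΣV-* {m} (- 1#) origin) ⟨
      ΣV {m} (λ _ → 1#) + ΣV {m} (λ x → - 1# * origin x) ≈⟨ ΣV-+ {m} (λ _ → 1#) (λ x → - 1# * origin x) ⟨
      ΣV {m} (λ x → 1# + - 1# * origin x)            ≈⟨ ΣV-cong {m} (power-indicator P hom no-zero) ⟨
      ΣV {m} (λ x → evalP P x ^ N)                   ≈⟨ ΣV-cong {m} (evalP-pow P N) ⟨
      ΣV {m} (evalP (powP P N))                      ≈⟨ polynomial-sum (powP P N) (homogeneous-pow P N hom) degree< ⟩
      0#                                         ∎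

module CubicZero (K : FiniteField) {m : ℕ} (c : CubicForm K m) where
  open FiniteField K hiding (zero)
  open Sums K
  open Polynomials K
  open CubicCalculus K c using (Point; IsZero; F)

  term : Fin m → Fin m → Fin m → Poly m
  term i j k = (c i j k , i ∷ j ∷ k ∷ []) ∷ []

  cubic : Poly m
  cubic = ΣP λ i → ΣP λ j → ΣP λ k → term i j k

  cubic-eval : ∀ x → evalP cubic x ≈ F x
  cubic-eval x =
    trans (evalP-ΣP (λ i → ΣP λ j → ΣP λ k → term i j k) x) (ΣF-cong {m} λ i →
    trans (evalP-ΣP (λ j → ΣP λ k → term i j k) x) (ΣF-cong {m} λ j →
    trans (evalP-ΣP (λ k → term i j k) x) (ΣF-cong {m} λ k →
    trans (+-identityʳ _) (*-congˡ (*-congˡ (*-congˡ (*-identityʳ (x k))))))))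

  cubic-homogeneous : Homogeneous 3 cubic
  cubic-homogeneous =
    homogeneous-ΣP (λ i → ΣP λ j → ΣP λ k → term i j k) λ i →
    homogeneous-ΣP (λ j → ΣP λ k → term i j k) λ j →
    homogeneous-ΣP (λ k → term i j k) λ k → ≡.refl ∷ []

  nontrivial-zero : 4 ≤ m → Σ Point λ x → ¬ IsZero x × F x ≈ 0#
  nontrivial-zero 4≤m =
    let x , x≉0 , Px≈0 = ChevalleyWarning.chevalley-warning K cubic cubic-homogeneous 4≤m
    in x , x≉0 , trans (sym (cubic-eval x)) Px≈0

lemma9 : (K : FiniteField) → (m : ℕ) → 4 ≤ m → (F : CubicForm K m) →
    NonDegenerate K F →
    Σ (Fin m → FiniteField.Carrier K) λ x →
    ¬ (∀ i → FiniteField._≈_ K (x i) (FiniteField.0# K))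
    × FiniteField._≈_ K (eval K F x) (FiniteField.0# K)
    × ¬ (∀ l → FiniteField._≈_ K (grad K F x l) (FiniteField.0# K))
lemma9 K m 4≤m c nondegenerate =
  fromInj₁ (λ none → ⊥-elim (no-nonsingular-zero none))
           (FieldSums.search K NonsingularZero nonsingularZero-resp nonsingularZero?)
  where
  open FiniteField K hiding (zero)
  open CubicCalculus K c
  -- Without non-singular zeros, the zero a ≠ 0 from Chevalley–Warning is
  -- singular with vanishing polar, which makes F degenerate.
  no-nonsingular-zero : (∀ x → ¬ NonsingularZero x) → ⊥
  no-nonsingular-zero none =
    let a , a≉0 , Fa≈0 = CubicZero.nontrivial-zero K c 4≤m
        a-singular : ∀ y → D a y ≈ 0#
        a-singular = D-singular a (decidable-stable (FinP.all? (λ l → ∇F a l ≟ 0#))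
                                    (λ ∇Fa≉0 → none a (a≉0 , Fa≈0 , ∇Fa≉0)))
    in Degeneracy.degenerate K c a Fa≈0 a-singular (polar-vanishes none a a≉0 Fa≈0 a-singular) a≉0 nondegenerate
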